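{- Let $d_1,\ldots,d_n$ be pairwise coprime positive integers, let $a_i=\prod_{j\ne i}d_j$ for $1\le i\le n$, let $p=d_1\cdots d_n$ and $\sigma=a_1+\cdots+a_n$, and let $\vec a=(a_1,\ldots,a_n)$. Other than $k=0$, the only $k\in\mathbb{Z}_{\ge0}$ with $c_{=k}>0$ are $k=\binom{s+n-1}{n-1}$ for $s\in\mathbb{Z}_{\ge 0}$, and for $k=\binom{s+n-1}{n-1}$ with $s\in\mathbb{Z}_{\ge0}$ we have \begin{align*} g_{=k}=g_{\le k}&=(s+n)p-\sigma,\\ h_{=k}=h_{\ge k}&=sp,\\ c_{=k}&=p,\\ c_{\le k}&=(s+1)p+\frac{(n-1)p-\sigma+1}{2},\\ s_{=k}&=\frac{p\big((2s+n)p-\sigma\big)}{2},\\ F_{=k}(x)&=\frac{x^{sp}(1-x^p)^n}{(1-x^{a_1})\cdots(1-x^{a_n})},\\ F_{\ge k}(x)&=\frac{x^{sp}(1-x^p)^{n-1}}{(1-x^{a_1})\cdots(1-x^{a_n})}. \end{align*}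
   Context: For $t\in\mathbb{Z}_{\ge 0}$, $f(t)=\#\{(x_1,\ldots,x_n)\in\mathbb{Z}_{\ge 0}^n:\ a_1x_1+\cdots+a_nx_n=t\}$. For $k\in\mathbb{Z}_{\ge0}$: $g_{=k}$ (resp. $g_{\le k}$) is the maximum $t\ge0$ with $f(t)=k$ (resp. $f(t)\le k$); $h_{=k}$ (resp. $h_{\ge k}$) is the minimum $t\ge 0$ with $f(t)=k$ (resp. $f(t)\ge k$); $c_{=k}$ (resp. $c_{\le k}$) is the number of $t\ge0$ with $f(t)=k$ (resp. $f(t)\le k$); $s_{=k}$ is the sum of all $t\ge 0$ with $f(t)=k$; $F_{=k}(x)=\sum_{t\ge0:\,f(t)=k}x^t$ and $F_{\ge k}(x)=\sum_{t\ge0:\,f(t)\ge k}x^t$. -}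

module Defs where

open import Data.Nat using (ℕ; zero; suc; _+_; _*_; _∸_; _≤_; _<_; _≟_; _≤?_)
open import Data.Nat.Properties using ()
open import Data.Nat.Coprimality using (Coprime)
open import Data.Fin using (Fin)
import Data.Fin as Fin
open import Data.Nat.ListAction using (sum; product)
open import Data.List using (List; []; _∷_; map; filter; upTo; allFin; foldr; length)
open import Data.Integer as ℤ using (ℤ)
open import Data.Product using (Σ; _×_; _,_)
open import Relation.Nullary using (¬_; ¬?; yes; no)
open import Relation.Unary using (Pred; Decidable)
open import Level using (0ℓ)
open import Relation.Binary.PropositionalEquality using (_≡_; _≢_)

-- f(t) for the coefficient list (a₁,…,aₙ): the number of (x₁,…,xₙ) ∈ ℕⁿ
-- with a₁x₁+⋯+aₙxₙ = t.  Computed by summing over the value of the first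
-- variable x (only x with x·a ≤ t can occur; correct for positive aᵢ).
solutions : List ℕ → ℕ → ℕ
solutions [] zero = 1
solutions [] (suc t) = 0
solutions (a ∷ as) t =
  sum (map (λ x → solutions as (t ∸ x * a)) (filter (λ x → x * a ≤? t) (upTo (suc t))))

aOf : ∀ {n} → (Fin n → ℕ) → Fin n → ℕ
aOf {n} d i = product (map d (filter (λ j → ¬? (j Fin.≟ i)) (allFin n)))

pOf : ∀ {n} → (Fin n → ℕ) → ℕ
pOf {n} d = product (map d (allFin n))

σOf : ∀ {n} → (Fin n → ℕ) → ℕ
σOf {n} d = sum (map (aOf d) (allFin n))

aList : ∀ {n} → (Fin n → ℕ) → List ℕ
aList {n} d = map (aOf d) (allFin n)

PairwiseCoprime : ∀ {n} → (Fin n → ℕ) → Set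
PairwiseCoprime d = ∀ i j → i ≢ j → Coprime (d i) (d j)

IsMax : Pred ℕ 0ℓ → ℕ → Set
IsMax P m = P m × (∀ t → m < t → ¬ P t)

IsMin : Pred ℕ 0ℓ → ℕ → Set
IsMin P m = P m × (∀ t → t < m → ¬ P t)

countBelow : {P : Pred ℕ 0ℓ} → Decidable P → ℕ → ℕ
countBelow P? B = length (filter P? (upTo B))

sumBelow : {P : Pred ℕ 0ℓ} → Decidable P → ℕ → ℕ
sumBelow P? B = sum (filter P? (upTo B))

HasCount : {P : Pred ℕ 0ℓ} → Decidable P → ℕ → Set
HasCount {P} P? C = Σ ℕ (λ B → (∀ t → B ≤ t → ¬ P t) × countBelow P? B ≡ C)

HasSum : {P : Pred ℕ 0ℓ} → Decidable P → ℕ → Set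
HasSum {P} P? S = Σ ℕ (λ B → (∀ t → B ≤ t → ¬ P t) × sumBelow P? B ≡ S)

PS : Set
PS = ℕ → ℤ

sumℤ : List ℤ → ℤ
sumℤ = foldr ℤ._+_ (ℤ.+ 0)

_⊛_ : PS → PS → PS
(F ⊛ G) m = sumℤ (map (λ i → F i ℤ.* G (m ∸ i)) (upTo (suc m)))

xPow : ℕ → PS
xPow e m with m ≟ e
... | yes _ = ℤ.+ 1
... | no _ = ℤ.+ 0

psOne : PS
psOne = xPow 0

_⊝_ : PS → PS → PS
(F ⊝ G) m = F m ℤ.- G m

oneMinusXPow : ℕ → PS
oneMinusXPow e = psOne ⊝ xPow e

psPow : PS → ℕ → PS
psPow F zero = psOne
psPow F (suc k) = F ⊛ psPow F k

psProd : List PS → PS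
psProd = foldr _⊛_ psOne

indicatorSeries : {P : Pred ℕ 0ℓ} → Decidable P → PS
indicatorSeries P? t with P? t
... | yes _ = ℤ.+ 1
... | no _ = ℤ.+ 0

_≈ₚ_ : PS → PS → Set
F ≈ₚ G = ∀ m → F m ≡ G m

infixl 7 _⊛_
infixl 6 _⊝_
infix 4 _≈ₚ_

-- Let R be the list of the p numbers ∑ᵢ rᵢaᵢ with 0 ≤ rᵢ < dᵢ. Each aⱼ with j ≠ i is divisible by dᵢ while aᵢ is
-- coprime to dᵢ, so the elements of R are pairwise incongruent modulo p: R is a complete residue system.
-- Since (1 - x^aᵢ)(1 + x^aᵢ + ⋯ + x^((dᵢ-1)aᵢ)) = 1 - x^p, the generating function of f is
--   ∏ᵢ 1/(1 - x^aᵢ) = (∑_{r ∈ R} x^r) / (1 - x^p)ⁿ.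
-- Hence f(r + jp) = C(j+n-1, n-1) for r ∈ R, while f vanishes below the representative in R of each residue
-- class. Every claim is read off from this staircase shape, using that min R = 0, max R = ∑ᵢ (dᵢ - 1)aᵢ = np - σ
-- and 2 ∑R = p · max R.

module Submission where

open import Defs
open import Algebra.Bundles using (CommutativeMonoid)
open import Data.Bool using (true; false; if_then_else_)
open import Data.Fin as Fin using (Fin)
open import Data.Integer as ℤ using (ℤ; 0ℤ; 1ℤ)
import Data.Integer.Properties as ℤP
open import Data.Integer.Tactic.RingSolver using () renaming (solve-∀ to ℤ-solve-∀)
open import Data.List using (List; []; _∷_; _++_; map; filter; foldr; length; applyUpTo; upTo; allFin; concatMap)
open import Data.List.Membership.Propositional using (_∈_; _∉_)
open import Data.List.Membership.Propositional.Properties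
  using (∈-map⁻; ∈-map⁺; ∈-++⁻; ∈-++⁺ˡ; ∈-++⁺ʳ; ∈-applyUpTo⁺; ∈-applyUpTo⁻; ∈-allFin; ∈-filter⁺)
open import Data.List.Properties using (map-id; map-cong; map-∘; length-map; length-++; length-applyUpTo; length-tabulate; filter-all)
open import Data.List.Relation.Unary.All using (All; []; _∷_)
import Data.List.Relation.Unary.All as All
import Data.List.Relation.Unary.All.Properties as All
open import Data.List.Relation.Unary.AllPairs using (AllPairs; []; _∷_)
import Data.List.Relation.Unary.AllPairs as AllPairs
import Data.List.Relation.Unary.AllPairs.Properties as AllPairs
open import Data.List.Relation.Unary.Any using (here; there)
open import Data.List.Relation.Unary.Unique.Propositional using (Unique)
open import Data.List.Relation.Unary.Unique.Propositional.Properties using (applyUpTo⁺₁; allFin⁺)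
open import Data.Nat using (ℕ; zero; suc; pred; _+_; _*_; _∸_; _≤_; _<_; _≥_; _≟_; _≤?_; _≥?_; _<?_; z≤n; s≤s; NonZero; >-nonZero; >-nonZero⁻¹)
import Data.Nat.Properties as ℕP
open import Data.List.Membership.DecPropositional _≟_ using (_∈?_)
open import Data.Nat.Combinatorics using (_C_; nCn≡1; nCk+nC[k+1]≡[n+1]C[k+1])
open import Data.Nat.Coprimality using (Coprime; coprime-divisor; 1-coprimeTo)
import Data.Nat.Coprimality as Coprime
open import Data.Nat.Divisibility using (_∣_; divides; _∣0; ∣-trans; ∣m∣n⇒∣m+n; ∣n⇒∣m*n; n∣m*n; m∣m*n; ∣⇒≤; m%n≡0⇒n∣m)
open import Data.Nat.DivMod
  using (_%_; _/_; m≡m%n+[m/n]*n; m%n<n; m<n⇒m%n≡m; [m+n]%n≡m%n; [m+kn]%n≡m%n; %-remove-+ʳ; m∣n⇒o%n%m≡o%m;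
         +-distrib-/-∣ʳ; m*n/n≡m; /-monoˡ-≤)
open import Data.Nat.ListAction using (sum; product)
open import Data.Nat.ListAction.Properties using (sum-++; ∈⇒∣product; product≢0)
open import Data.Nat.Tactic.RingSolver using () renaming (solve-∀ to ℕ-solve-∀)
open import Data.Product using (Σ; ∃; ∃₂; _×_; _,_)
open import Data.Sum using (_⊎_; inj₁; inj₂)
open import Function using (_∘_; case_of_)
open import Level using (0ℓ)
open import Relation.Binary.Bundles using (Setoid)
import Relation.Binary.Reasoning.Setoid as SetoidReasoning
open import Relation.Binary.PropositionalEquality using (_≡_; _≢_; refl; sym; trans; cong; cong₂; subst; subst₂; module ≡-Reasoning)
open import Relation.Nullary using (yes; no; Dec; does; ¬_; ¬?; contradiction)
open import Relation.Unary using (Pred; Decidable)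

module RangeSum {c ℓ} (M : CommutativeMonoid c ℓ) where

  open CommutativeMonoid M
    using (_≈_; _∙_; ε; ∙-cong; ∙-congˡ; ∙-congʳ; assoc; identityˡ; identityʳ; setoid; commutativeSemigroup)
    renaming (Carrier to A)
  open Setoid setoid using () renaming (refl to ≈-refl; sym to ≈-sym; trans to ≈-trans)
  open import Algebra.Properties.CommutativeSemigroup commutativeSemigroup using (interchange)
  open import Relation.Binary.Reasoning.Setoid setoid

  ∑< : ℕ → (ℕ → A) → A
  ∑< zero f = ε
  ∑< (suc n) f = f 0 ∙ ∑< n (f ∘ suc)

  foldr-applyUpTo : ∀ (g : ℕ → A) h n → foldr _∙_ ε (map g (applyUpTo h n)) ≡ ∑< n (g ∘ h)
  foldr-applyUpTo g h zero = refl
  foldr-applyUpTo g h (suc n) = cong (g (h 0) ∙_) (foldr-applyUpTo g (h ∘ suc) n)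

  ∑<-cong : ∀ {f g : ℕ → A} n → (∀ i → i < n → f i ≈ g i) → ∑< n f ≈ ∑< n g
  ∑<-cong zero _ = ≈-refl
  ∑<-cong (suc n) f≈g = ∙-cong (f≈g 0 (s≤s z≤n)) (∑<-cong n (λ i i<n → f≈g (suc i) (s≤s i<n)))

  ∑<-zero : ∀ {f : ℕ → A} n → (∀ i → i < n → f i ≈ ε) → ∑< n f ≈ ε
  ∑<-zero zero _ = ≈-refl
  ∑<-zero (suc n) f≈ε = ≈-trans (∙-cong (f≈ε 0 (s≤s z≤n)) (∑<-zero n (λ i i<n → f≈ε (suc i) (s≤s i<n)))) (identityˡ ε)

  ∑<-single : ∀ {f : ℕ → A} n k → k < n → (∀ i → i < n → i ≢ k → f i ≈ ε) → ∑< n f ≈ f k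
  ∑<-single (suc n) zero _ f≈ε =
    ≈-trans (∙-congˡ (∑<-zero n (λ i i<n → f≈ε (suc i) (s≤s i<n) (λ ())))) (identityʳ _)
  ∑<-single (suc n) (suc k) (s≤s k<n) f≈ε =
    ≈-trans (∙-congʳ (f≈ε 0 (s≤s z≤n) (λ ())))
      (≈-trans (identityˡ _) (∑<-single n k k<n (λ i i<n i≢k → f≈ε (suc i) (s≤s i<n) (i≢k ∘ ℕP.suc-injective))))

  ∑<-extend : ∀ {f : ℕ → A} m n → m ≤ n → (∀ i → m ≤ i → f i ≈ ε) → ∑< n f ≈ ∑< m f
  ∑<-extend zero n _ f≈ε = ∑<-zero n (λ i _ → f≈ε i z≤n)
  ∑<-extend (suc m) (suc n) (s≤s m≤n) f≈ε = ∙-congˡ (∑<-extend m n m≤n (λ i m≤i → f≈ε (suc i) (s≤s m≤i)))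

  ∑<-snoc : ∀ (f : ℕ → A) n → ∑< (suc n) f ≈ ∑< n f ∙ f n
  ∑<-snoc f zero = ≈-trans (identityʳ (f 0)) (≈-sym (identityˡ (f 0)))
  ∑<-snoc f (suc n) = ≈-trans (∙-congˡ (∑<-snoc (f ∘ suc) n)) (≈-sym (assoc (f 0) _ _))

  ∑<-distrib : ∀ (f g : ℕ → A) n → ∑< n (λ i → f i ∙ g i) ≈ ∑< n f ∙ ∑< n g
  ∑<-distrib f g zero = ≈-sym (identityˡ ε)
  ∑<-distrib f g (suc n) = begin
    (f 0 ∙ g 0) ∙ ∑< n (λ i → f (suc i) ∙ g (suc i))   ≈⟨ ∙-congˡ (∑<-distrib (f ∘ suc) (g ∘ suc) n) ⟩
    (f 0 ∙ g 0) ∙ (∑< n (f ∘ suc) ∙ ∑< n (g ∘ suc))   ≈⟨ interchange (f 0) (g 0) _ _ ⟩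
    (f 0 ∙ ∑< n (f ∘ suc)) ∙ (g 0 ∙ ∑< n (g ∘ suc))   ∎

module ℕΣ = RangeSum ℕP.+-0-commutativeMonoid
module ℤΣ = RangeSum ℤP.+-0-commutativeMonoid

open ℤΣ using (∑<)

∑<-*ˡ : ∀ c (f : ℕ → ℤ) n → ∑< n (λ i → c ℤ.* f i) ≡ c ℤ.* ∑< n f
∑<-*ˡ c f zero = sym (ℤP.*-zeroʳ c)
∑<-*ˡ c f (suc n) = trans (cong (ℤ._+_ (c ℤ.* f 0)) (∑<-*ˡ c (f ∘ suc) n)) (sym (ℤP.*-distribˡ-+ c (f 0) _))

∑<-neg : ∀ (f : ℕ → ℤ) n → ∑< n (λ i → ℤ.- f i) ≡ ℤ.- ∑< n f
∑<-neg f zero = refl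
∑<-neg f (suc n) = trans (cong (ℤ._+_ (ℤ.- f 0)) (∑<-neg (f ∘ suc) n)) (sym (ℤP.neg-distrib-+ (f 0) _))

-- Formal power series

≈ₚ-setoid : Setoid 0ℓ 0ℓ
≈ₚ-setoid = record
  { Carrier = PS
  ; _≈_ = _≈ₚ_
  ; isEquivalence = record
    { refl = λ _ → refl
    ; sym = λ F≈G m → sym (F≈G m)
    ; trans = λ F≈G G≈H m → trans (F≈G m) (G≈H m)
    }
  }

open Setoid ≈ₚ-setoid using () renaming (refl to ≈ₚ-refl; sym to ≈ₚ-sym; trans to ≈ₚ-trans)

module ≈ₚ-Reasoning = SetoidReasoning ≈ₚ-setoid

tailₚ : PS → PS
tailₚ F = F ∘ suc

_⊕_ : PS → PS → PS
(F ⊕ G) m = F m ℤ.+ G m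

⊖_ : PS → PS
(⊖ F) m = ℤ.- F m

_·ₚ_ : ℤ → PS → PS
(c ·ₚ F) m = c ℤ.* F m

0ₚ : PS
0ₚ _ = 0ℤ

infixl 6 _⊕_

⊛-coeff : ∀ F G m → (F ⊛ G) m ≡ ∑< (suc m) (λ i → F i ℤ.* G (m ∸ i))
⊛-coeff F G m = ℤΣ.foldr-applyUpTo (λ i → F i ℤ.* G (m ∸ i)) (λ i → i) (suc m)

⊛-coeff-zero : ∀ F G → (F ⊛ G) 0 ≡ F 0 ℤ.* G 0 ℤ.+ 0ℤ
⊛-coeff-zero F G = ⊛-coeff F G 0

⊛-coeff-suc : ∀ F G m → (F ⊛ G) (suc m) ≡ F 0 ℤ.* G (suc m) ℤ.+ (tailₚ F ⊛ G) m
⊛-coeff-suc F G m = trans (⊛-coeff F G (suc m)) (cong (ℤ._+_ (F 0 ℤ.* G (suc m))) (sym (⊛-coeff (tailₚ F) G m)))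

⊛-coeff-sucʳ : ∀ F G m → (F ⊛ G) (suc m) ≡ (F ⊛ tailₚ G) m ℤ.+ F (suc m) ℤ.* G 0
⊛-coeff-sucʳ F G m = begin
  (F ⊛ G) (suc m)                                                   ≡⟨ ⊛-coeff F G (suc m) ⟩
  ∑< (suc (suc m)) (λ i → F i ℤ.* G (suc m ∸ i))                    ≡⟨ ℤΣ.∑<-snoc (λ i → F i ℤ.* G (suc m ∸ i)) (suc m) ⟩
  ∑< (suc m) (λ i → F i ℤ.* G (suc m ∸ i)) ℤ.+ F (suc m) ℤ.* G (suc m ∸ suc m)
    ≡⟨ cong₂ ℤ._+_ (ℤΣ.∑<-cong (suc m) (λ i i≤m → cong (λ j → F i ℤ.* G j) (ℕP.+-∸-assoc 1 (ℕP.≤-pred i≤m))))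
                   (cong (λ j → F (suc m) ℤ.* G j) (ℕP.n∸n≡0 m)) ⟩
  ∑< (suc m) (λ i → F i ℤ.* tailₚ G (m ∸ i)) ℤ.+ F (suc m) ℤ.* G 0 ≡⟨ cong (ℤ._+ F (suc m) ℤ.* G 0) (sym (⊛-coeff F (tailₚ G) m)) ⟩
  (F ⊛ tailₚ G) m ℤ.+ F (suc m) ℤ.* G 0                             ∎
  where open ≡-Reasoning

⊛-cong : ∀ {F F′ G G′} → F ≈ₚ F′ → G ≈ₚ G′ → F ⊛ G ≈ₚ F′ ⊛ G′
⊛-cong {F} {F′} {G} {G′} F≈F′ G≈G′ m = begin
  (F ⊛ G) m                                ≡⟨ ⊛-coeff F G m ⟩
  ∑< (suc m) (λ i → F i ℤ.* G (m ∸ i))     ≡⟨ ℤΣ.∑<-cong (suc m) (λ i _ → cong₂ ℤ._*_ (F≈F′ i) (G≈G′ (m ∸ i))) ⟩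
  ∑< (suc m) (λ i → F′ i ℤ.* G′ (m ∸ i))   ≡⟨ ⊛-coeff F′ G′ m ⟨
  (F′ ⊛ G′) m                              ∎
  where open ≡-Reasoning

⊛-congˡ : ∀ {F F′} G → F ≈ₚ F′ → F ⊛ G ≈ₚ F′ ⊛ G
⊛-congˡ G F≈F′ = ⊛-cong F≈F′ (≈ₚ-refl {G})

⊛-congʳ : ∀ F {G G′} → G ≈ₚ G′ → F ⊛ G ≈ₚ F ⊛ G′
⊛-congʳ F G≈G′ = ⊛-cong (≈ₚ-refl {F}) G≈G′

⊛-comm : ∀ F G → F ⊛ G ≈ₚ G ⊛ F
⊛-comm F G zero = begin
  (F ⊛ G) 0             ≡⟨ ⊛-coeff-zero F G ⟩
  F 0 ℤ.* G 0 ℤ.+ 0ℤ    ≡⟨ cong (ℤ._+ 0ℤ) (ℤP.*-comm (F 0) (G 0)) ⟩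
  G 0 ℤ.* F 0 ℤ.+ 0ℤ    ≡⟨ ⊛-coeff-zero G F ⟨
  (G ⊛ F) 0             ∎
  where open ≡-Reasoning
⊛-comm F G (suc m) = begin
  (F ⊛ G) (suc m)                          ≡⟨ ⊛-coeff-suc F G m ⟩
  F 0 ℤ.* G (suc m) ℤ.+ (tailₚ F ⊛ G) m    ≡⟨ cong₂ ℤ._+_ (ℤP.*-comm (F 0) (G (suc m))) (⊛-comm (tailₚ F) G m) ⟩
  G (suc m) ℤ.* F 0 ℤ.+ (G ⊛ tailₚ F) m    ≡⟨ ℤP.+-comm (G (suc m) ℤ.* F 0) ((G ⊛ tailₚ F) m) ⟩
  (G ⊛ tailₚ F) m ℤ.+ G (suc m) ℤ.* F 0    ≡⟨ ⊛-coeff-sucʳ G F m ⟨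
  (G ⊛ F) (suc m)                          ∎
  where open ≡-Reasoning

⊛-distribʳ-⊕ : ∀ F G H → (F ⊕ G) ⊛ H ≈ₚ F ⊛ H ⊕ G ⊛ H
⊛-distribʳ-⊕ F G H m = begin
  ((F ⊕ G) ⊛ H) m                                                           ≡⟨ ⊛-coeff (F ⊕ G) H m ⟩
  ∑< (suc m) (λ i → (F i ℤ.+ G i) ℤ.* H (m ∸ i))                            ≡⟨ ℤΣ.∑<-cong (suc m) (λ i _ → ℤP.*-distribʳ-+ (H (m ∸ i)) (F i) (G i)) ⟩
  ∑< (suc m) (λ i → F i ℤ.* H (m ∸ i) ℤ.+ G i ℤ.* H (m ∸ i))                ≡⟨ ℤΣ.∑<-distrib (λ i → F i ℤ.* H (m ∸ i)) (λ i → G i ℤ.* H (m ∸ i)) (suc m) ⟩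
  ∑< (suc m) (λ i → F i ℤ.* H (m ∸ i)) ℤ.+ ∑< (suc m) (λ i → G i ℤ.* H (m ∸ i)) ≡⟨ cong₂ ℤ._+_ (⊛-coeff F H m) (⊛-coeff G H m) ⟨
  (F ⊛ H) m ℤ.+ (G ⊛ H) m                                                   ∎
  where open ≡-Reasoning

·ₚ-⊛ : ∀ c F H → (c ·ₚ F) ⊛ H ≈ₚ c ·ₚ (F ⊛ H)
·ₚ-⊛ c F H m = begin
  ((c ·ₚ F) ⊛ H) m                              ≡⟨ ⊛-coeff (c ·ₚ F) H m ⟩
  ∑< (suc m) (λ i → c ℤ.* F i ℤ.* H (m ∸ i))    ≡⟨ ℤΣ.∑<-cong (suc m) (λ i _ → ℤP.*-assoc c (F i) (H (m ∸ i))) ⟩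
  ∑< (suc m) (λ i → c ℤ.* (F i ℤ.* H (m ∸ i)))  ≡⟨ ∑<-*ˡ c (λ i → F i ℤ.* H (m ∸ i)) (suc m) ⟩
  c ℤ.* ∑< (suc m) (λ i → F i ℤ.* H (m ∸ i))    ≡⟨ cong (c ℤ.*_) (⊛-coeff F H m) ⟨
  c ℤ.* (F ⊛ H) m                               ∎
  where open ≡-Reasoning

⊖-⊛ : ∀ F H → (⊖ F) ⊛ H ≈ₚ ⊖ (F ⊛ H)
⊖-⊛ F H m = begin
  ((⊖ F) ⊛ H) m                                ≡⟨ ⊛-coeff (⊖ F) H m ⟩
  ∑< (suc m) (λ i → ℤ.- F i ℤ.* H (m ∸ i))     ≡⟨ ℤΣ.∑<-cong (suc m) (λ i _ → sym (ℤP.neg-distribˡ-* (F i) (H (m ∸ i)))) ⟩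
  ∑< (suc m) (λ i → ℤ.- (F i ℤ.* H (m ∸ i)))   ≡⟨ ∑<-neg (λ i → F i ℤ.* H (m ∸ i)) (suc m) ⟩
  ℤ.- ∑< (suc m) (λ i → F i ℤ.* H (m ∸ i))     ≡⟨ cong ℤ.-_ (⊛-coeff F H m) ⟨
  ℤ.- (F ⊛ H) m                                ∎
  where open ≡-Reasoning

⊛-assoc : ∀ F G H → (F ⊛ G) ⊛ H ≈ₚ F ⊛ (G ⊛ H)
⊛-assoc F G H zero = begin
  ((F ⊛ G) ⊛ H) 0                        ≡⟨ ⊛-coeff-zero (F ⊛ G) H ⟩
  (F ⊛ G) 0 ℤ.* H 0 ℤ.+ 0ℤ               ≡⟨ cong (λ x → x ℤ.* H 0 ℤ.+ 0ℤ) (⊛-coeff-zero F G) ⟩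
  (F 0 ℤ.* G 0 ℤ.+ 0ℤ) ℤ.* H 0 ℤ.+ 0ℤ    ≡⟨ reassoc (F 0) (G 0) (H 0) ⟩
  F 0 ℤ.* (G 0 ℤ.* H 0 ℤ.+ 0ℤ) ℤ.+ 0ℤ    ≡⟨ cong (λ x → F 0 ℤ.* x ℤ.+ 0ℤ) (⊛-coeff-zero G H) ⟨
  F 0 ℤ.* (G ⊛ H) 0 ℤ.+ 0ℤ               ≡⟨ ⊛-coeff-zero F (G ⊛ H) ⟨
  (F ⊛ (G ⊛ H)) 0                        ∎
  where
  open ≡-Reasoning
  reassoc : ∀ a b c → (a ℤ.* b ℤ.+ 0ℤ) ℤ.* c ℤ.+ 0ℤ ≡ a ℤ.* (b ℤ.* c ℤ.+ 0ℤ) ℤ.+ 0ℤ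
  reassoc = ℤ-solve-∀
⊛-assoc F G H (suc m) = begin
  ((F ⊛ G) ⊛ H) (suc m)                                                  ≡⟨ ⊛-coeff-suc (F ⊛ G) H m ⟩
  (F ⊛ G) 0 ℤ.* H (suc m) ℤ.+ (tailₚ (F ⊛ G) ⊛ H) m                      ≡⟨ cong₂ (λ x y → x ℤ.* H (suc m) ℤ.+ y) (⊛-coeff-zero F G) (⊛-congˡ H (⊛-coeff-suc F G) m) ⟩
  (F 0 ℤ.* G 0 ℤ.+ 0ℤ) ℤ.* H (suc m) ℤ.+ ((F 0 ·ₚ tailₚ G ⊕ tailₚ F ⊛ G) ⊛ H) m
    ≡⟨ cong (ℤ._+_ ((F 0 ℤ.* G 0 ℤ.+ 0ℤ) ℤ.* H (suc m)))
         (trans (⊛-distribʳ-⊕ (F 0 ·ₚ tailₚ G) (tailₚ F ⊛ G) H m) (cong₂ ℤ._+_ (·ₚ-⊛ (F 0) (tailₚ G) H m) (⊛-assoc (tailₚ F) G H m))) ⟩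
  (F 0 ℤ.* G 0 ℤ.+ 0ℤ) ℤ.* H (suc m) ℤ.+ (F 0 ℤ.* (tailₚ G ⊛ H) m ℤ.+ (tailₚ F ⊛ (G ⊛ H)) m)
    ≡⟨ regroup (F 0) (G 0) (H (suc m)) ((tailₚ G ⊛ H) m) ((tailₚ F ⊛ (G ⊛ H)) m) ⟩
  F 0 ℤ.* (G 0 ℤ.* H (suc m) ℤ.+ (tailₚ G ⊛ H) m) ℤ.+ (tailₚ F ⊛ (G ⊛ H)) m ≡⟨ cong (λ x → F 0 ℤ.* x ℤ.+ (tailₚ F ⊛ (G ⊛ H)) m) (⊛-coeff-suc G H m) ⟨
  F 0 ℤ.* (G ⊛ H) (suc m) ℤ.+ (tailₚ F ⊛ (G ⊛ H)) m                      ≡⟨ ⊛-coeff-suc F (G ⊛ H) m ⟨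
  (F ⊛ (G ⊛ H)) (suc m)                                                  ∎
  where
  open ≡-Reasoning
  regroup : ∀ a b c x y → (a ℤ.* b ℤ.+ 0ℤ) ℤ.* c ℤ.+ (a ℤ.* x ℤ.+ y) ≡ a ℤ.* (b ℤ.* c ℤ.+ x) ℤ.+ y
  regroup = ℤ-solve-∀

⊛-interchange : ∀ F G H K → (F ⊛ G) ⊛ (H ⊛ K) ≈ₚ (F ⊛ H) ⊛ (G ⊛ K)
⊛-interchange F G H K = begin
  (F ⊛ G) ⊛ (H ⊛ K)     ≈⟨ ⊛-assoc F G (H ⊛ K) ⟩
  F ⊛ (G ⊛ (H ⊛ K))     ≈⟨ ⊛-congʳ F (⊛-assoc G H K) ⟨
  F ⊛ ((G ⊛ H) ⊛ K)     ≈⟨ ⊛-congʳ F (⊛-congˡ K (⊛-comm G H)) ⟩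
  F ⊛ ((H ⊛ G) ⊛ K)     ≈⟨ ⊛-congʳ F (⊛-assoc H G K) ⟩
  F ⊛ (H ⊛ (G ⊛ K))     ≈⟨ ⊛-assoc F H (G ⊛ K) ⟨
  (F ⊛ H) ⊛ (G ⊛ K)     ∎
  where open ≈ₚ-Reasoning

⊛-distribʳ-⊝ : ∀ F G H → (F ⊝ G) ⊛ H ≈ₚ F ⊛ H ⊝ G ⊛ H
⊛-distribʳ-⊝ F G H m = trans (⊛-distribʳ-⊕ F (⊖ G) H m) (cong (ℤ._+_ ((F ⊛ H) m)) (⊖-⊛ G H m))

⊛-distribˡ-⊝ : ∀ F G H → F ⊛ (G ⊝ H) ≈ₚ F ⊛ G ⊝ F ⊛ H
⊛-distribˡ-⊝ F G H m =
  trans (⊛-comm F (G ⊝ H) m) (trans (⊛-distribʳ-⊝ G H F m) (cong₂ ℤ._-_ (⊛-comm G F m) (⊛-comm H F m)))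

⊛-zeroˡ : ∀ G → 0ₚ ⊛ G ≈ₚ 0ₚ
⊛-zeroˡ G m = trans (⊛-coeff 0ₚ G m) (ℤΣ.∑<-zero (suc m) (λ _ _ → refl))

xPow-diag : ∀ e → xPow e e ≡ 1ℤ
xPow-diag e with e ≟ e
... | yes _ = refl
... | no e≢e = contradiction refl e≢e

xPow-off : ∀ {e m} → m ≢ e → xPow e m ≡ 0ℤ
xPow-off {e} {m} m≢e with m ≟ e
... | yes m≡e = contradiction m≡e m≢e
... | no _ = refl

tail-xPow-suc : ∀ a → tailₚ (xPow (suc a)) ≈ₚ xPow a
tail-xPow-suc a m = case m ≟ a of λ where
  (yes refl) → trans (xPow-diag (suc a)) (sym (xPow-diag a))
  (no m≢a) → trans (xPow-off (m≢a ∘ ℕP.suc-injective)) (sym (xPow-off m≢a))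

xPow-suc-⊛ : ∀ a F m → (xPow (suc a) ⊛ F) (suc m) ≡ (xPow a ⊛ F) m
xPow-suc-⊛ a F m = begin
  (xPow (suc a) ⊛ F) (suc m)                                        ≡⟨ ⊛-coeff-suc (xPow (suc a)) F m ⟩
  xPow (suc a) 0 ℤ.* F (suc m) ℤ.+ (tailₚ (xPow (suc a)) ⊛ F) m     ≡⟨ cong₂ ℤ._+_ (cong (ℤ._* F (suc m)) (xPow-off {suc a} {0} (λ ()))) (⊛-congˡ F (tail-xPow-suc a) m) ⟩
  0ℤ ℤ.* F (suc m) ℤ.+ (xPow a ⊛ F) m                               ≡⟨ ℤP.+-identityˡ _ ⟩
  (xPow a ⊛ F) m                                                    ∎
  where open ≡-Reasoning

⊛-identityˡ : ∀ F → psOne ⊛ F ≈ₚ F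
⊛-identityˡ F zero = trans (⊛-coeff-zero psOne F) (trans (ℤP.+-identityʳ _) (ℤP.*-identityˡ (F 0)))
⊛-identityˡ F (suc m) = begin
  (psOne ⊛ F) (suc m)                                 ≡⟨ ⊛-coeff-suc psOne F m ⟩
  1ℤ ℤ.* F (suc m) ℤ.+ (tailₚ psOne ⊛ F) m            ≡⟨ cong₂ ℤ._+_ (ℤP.*-identityˡ (F (suc m))) (⊛-congˡ F (λ i → xPow-off {0} {suc i} (λ ())) m) ⟩
  F (suc m) ℤ.+ (0ₚ ⊛ F) m                            ≡⟨ cong (ℤ._+_ (F (suc m))) (⊛-zeroˡ F m) ⟩
  F (suc m) ℤ.+ 0ℤ                                    ≡⟨ ℤP.+-identityʳ _ ⟩
  F (suc m)                                           ∎
  where open ≡-Reasoning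

⊛-identityʳ : ∀ F → F ⊛ psOne ≈ₚ F
⊛-identityʳ F = ≈ₚ-trans (⊛-comm F psOne) (⊛-identityˡ F)

xPow-⊛-offset : ∀ a F m → (xPow a ⊛ F) (a + m) ≡ F m
xPow-⊛-offset zero F m = ⊛-identityˡ F m
xPow-⊛-offset (suc a) F m = trans (xPow-suc-⊛ a F (a + m)) (xPow-⊛-offset a F m)

xPow-⊛-below : ∀ a F m → m < a → (xPow a ⊛ F) m ≡ 0ℤ
xPow-⊛-below (suc a) F zero _ = trans (⊛-coeff-zero (xPow (suc a)) F) (cong (λ x → x ℤ.* F 0 ℤ.+ 0ℤ) (xPow-off {suc a} {0} (λ ())))
xPow-⊛-below (suc a) F (suc m) (s≤s m<a) = trans (xPow-suc-⊛ a F m) (xPow-⊛-below a F m m<a)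

data Split (a m : ℕ) : Set where
  below : m < a → Split a m
  offset : ∀ m′ → m ≡ a + m′ → Split a m

split : ∀ a m → Split a m
split a m with ℕP.<-≤-connex m a
... | inj₁ m<a = below m<a
... | inj₂ a≤m = offset (m ∸ a) (sym (ℕP.m+[n∸m]≡n a≤m))

≈ₚ-xPow-⊛ : ∀ c F G → (∀ t → t < c → F t ≡ 0ℤ) → (∀ t → F (c + t) ≡ G t) → F ≈ₚ xPow c ⊛ G
≈ₚ-xPow-⊛ c F G F<c≡0 F≡G t with split c t
... | below t<c = trans (F<c≡0 t t<c) (sym (xPow-⊛-below c G t t<c))
... | offset t′ refl = trans (F≡G t′) (sym (xPow-⊛-offset c G t′))

xPow-⊛-xPow : ∀ a b → xPow a ⊛ xPow b ≈ₚ xPow (a + b)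
xPow-⊛-xPow a b m with split a m
... | below m<a = trans (xPow-⊛-below a (xPow b) m m<a)
                    (sym (xPow-off (λ m≡a+b → ℕP.<⇒≱ m<a (subst (a ≤_) (sym m≡a+b) (ℕP.m≤m+n a b)))))
... | offset m′ refl = case m′ ≟ b of λ where
  (yes refl) → trans (xPow-⊛-offset a (xPow b) b) (trans (xPow-diag b) (sym (xPow-diag (a + b))))
  (no m′≢b) → trans (xPow-⊛-offset a (xPow b) m′)
                (trans (xPow-off m′≢b) (sym (xPow-off (m′≢b ∘ ℕP.+-cancelˡ-≡ a _ _))))

oneMinusXPow-⊛ : ∀ a F m → (oneMinusXPow a ⊛ F) m ≡ F m ℤ.- (xPow a ⊛ F) m
oneMinusXPow-⊛ a F m = trans (⊛-distribʳ-⊝ psOne (xPow a) F m) (cong (ℤ._- (xPow a ⊛ F) m) (⊛-identityˡ F m))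

oneMinusXPow-⊛-below : ∀ a F m → m < a → (oneMinusXPow a ⊛ F) m ≡ F m
oneMinusXPow-⊛-below a F m m<a =
  trans (oneMinusXPow-⊛ a F m) (trans (cong (ℤ._-_ (F m)) (xPow-⊛-below a F m m<a)) (ℤP.+-identityʳ (F m)))

oneMinusXPow-⊛-offset : ∀ a F m → (oneMinusXPow a ⊛ F) (a + m) ≡ F (a + m) ℤ.- F m
oneMinusXPow-⊛-offset a F m = trans (oneMinusXPow-⊛ a F (a + m)) (cong (ℤ._-_ (F (a + m))) (xPow-⊛-offset a F m))

geom : ℕ → ℕ → PS
geom a zero = 0ₚ
geom a (suc d) = psOne ⊕ xPow a ⊛ geom a d

geom-⊛-oneMinusXPow : ∀ a d → geom a d ⊛ oneMinusXPow a ≈ₚ oneMinusXPow (d * a)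
geom-⊛-oneMinusXPow a zero m = trans (⊛-zeroˡ (oneMinusXPow a) m) (sym (ℤP.+-inverseʳ (psOne m)))
geom-⊛-oneMinusXPow a (suc d) m = begin
  ((psOne ⊕ xPow a ⊛ geom a d) ⊛ A) m                       ≡⟨ ⊛-distribʳ-⊕ psOne (xPow a ⊛ geom a d) A m ⟩
  (psOne ⊛ A) m ℤ.+ ((xPow a ⊛ geom a d) ⊛ A) m
    ≡⟨ cong₂ ℤ._+_ (⊛-identityˡ A m) (trans (⊛-assoc (xPow a) (geom a d) A m)
         (trans (⊛-congʳ (xPow a) (geom-⊛-oneMinusXPow a d) m) (⊛-distribˡ-⊝ (xPow a) psOne (xPow (d * a)) m))) ⟩
  (psOne m ℤ.- xPow a m) ℤ.+ ((xPow a ⊛ psOne) m ℤ.- (xPow a ⊛ xPow (d * a)) m)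
    ≡⟨ cong₂ (λ x y → (psOne m ℤ.- xPow a m) ℤ.+ (x ℤ.- y)) (⊛-identityʳ (xPow a) m) (xPow-⊛-xPow a (d * a) m) ⟩
  (psOne m ℤ.- xPow a m) ℤ.+ (xPow a m ℤ.- xPow (a + d * a) m) ≡⟨ telescope (psOne m) (xPow a m) _ ⟩
  psOne m ℤ.- xPow (suc d * a) m                              ∎
  where
  open ≡-Reasoning
  A = oneMinusXPow a
  telescope : ∀ x y z → (x ℤ.- y) ℤ.+ (y ℤ.- z) ≡ x ℤ.- z
  telescope = ℤ-solve-∀

psProd-map-⊛ : ∀ {A : Set} (F G : A → PS) xs → psProd (map F xs) ⊛ psProd (map G xs) ≈ₚ psProd (map (λ x → F x ⊛ G x) xs)
psProd-map-⊛ F G [] = ⊛-identityˡ psOne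
psProd-map-⊛ F G (x ∷ xs) = ≈ₚ-trans (⊛-interchange (F x) (psProd (map F xs)) (G x) (psProd (map G xs)))
                                      (⊛-congʳ (F x ⊛ G x) (psProd-map-⊛ F G xs))

psProd-map-const : ∀ {A : Set} (F : A → PS) G xs → (∀ x → F x ≈ₚ G) → psProd (map F xs) ≈ₚ psPow G (length xs)
psProd-map-const F G [] _ = ≈ₚ-refl
psProd-map-const F G (x ∷ xs) F≈G = ⊛-cong (F≈G x) (psProd-map-const F G xs F≈G)

iverson : ∀ {P : Set} → Dec P → ℕ → ℕ
iverson P? v = if does P? then v else 0

iverson-yes : ∀ {P : Set} (P? : Dec P) → P → ∀ v → iverson P? v ≡ v
iverson-yes (yes _) _ v = refl
iverson-yes (no ¬p) p v = contradiction p ¬p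

iverson-no : ∀ {P : Set} (P? : Dec P) → ¬ P → ∀ v → iverson P? v ≡ 0
iverson-no (yes p) ¬p v = contradiction p ¬p
iverson-no (no _) _ v = refl

iverson-cong : ∀ {P Q : Set} (P? : Dec P) (Q? : Dec Q) → (P → Q) → (Q → P) → ∀ v → iverson P? v ≡ iverson Q? v
iverson-cong (yes _) (yes _) _ _ v = refl
iverson-cong (yes p) (no ¬q) P→Q _ v = contradiction (P→Q p) ¬q
iverson-cong (no ¬p) (yes q) _ Q→P v = contradiction (Q→P q) ¬p
iverson-cong (no _) (no _) _ _ v = refl

sum-map-filter : ∀ {P : Pred ℕ 0ℓ} (P? : Decidable P) (g : ℕ → ℕ) xs →
  sum (map g (filter P? xs)) ≡ sum (map (λ x → iverson (P? x) (g x)) xs)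
sum-map-filter P? g [] = refl
sum-map-filter P? g (x ∷ xs) with does (P? x)
... | true = cong (g x +_) (sum-map-filter P? g xs)
... | false = sum-map-filter P? g xs

sum-map-zero : ∀ (g : ℕ → ℕ) xs → (∀ {x} → x ∈ xs → g x ≡ 0) → sum (map g xs) ≡ 0
sum-map-zero g [] _ = refl
sum-map-zero g (x ∷ xs) g≡0 = cong₂ _+_ (g≡0 (here refl)) (sum-map-zero g xs (g≡0 ∘ there))

sum-map-single : ∀ (g : ℕ → ℕ) {xs x₀} → Unique xs → x₀ ∈ xs → (∀ {x} → x ∈ xs → x ≢ x₀ → g x ≡ 0) → sum (map g xs) ≡ g x₀
sum-map-single g {x ∷ xs} (x∉xs ∷ _) (here refl) g≡0 =
  trans (cong (g x +_) (sum-map-zero g xs (λ y∈xs → g≡0 (there y∈xs) (All.lookup x∉xs y∈xs ∘ sym)))) (ℕP.+-identityʳ (g x))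
sum-map-single g {x ∷ xs} (x∉xs ∷ xs!) (there x₀∈xs) g≡0 =
  cong₂ _+_ (g≡0 (here refl) (All.lookup x∉xs x₀∈xs)) (sum-map-single g xs! x₀∈xs (g≡0 ∘ there))

sum-map-+-distrib : ∀ {A : Set} (g h : A → ℕ) xs → sum (map (λ x → g x + h x) xs) ≡ sum (map g xs) + sum (map h xs)
sum-map-+-distrib g h [] = refl
sum-map-+-distrib g h (x ∷ xs) =
  trans (cong (g x + h x +_) (sum-map-+-distrib g h xs)) (interchange (g x) (h x) _ _)
  where interchange : ∀ a b c d → a + b + (c + d) ≡ a + c + (b + d)
        interchange = ℕ-solve-∀

sum-map-*ʳ : ∀ {A : Set} (g : A → ℕ) c xs → sum (map (λ x → g x * c) xs) ≡ sum (map g xs) * c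
sum-map-*ʳ g c [] = refl
sum-map-*ʳ g c (x ∷ xs) = trans (cong (g x * c +_) (sum-map-*ʳ g c xs)) (sym (ℕP.*-distribʳ-+ c (g x) _))

sum-map-const : ∀ {A : Set} c (xs : List A) → sum (map (λ _ → c) xs) ≡ length xs * c
sum-map-const c [] = refl
sum-map-const c (x ∷ xs) = cong (c +_) (sum-map-const c xs)

sum-map-+ˡ : ∀ c xs → sum (map (c +_) xs) ≡ length xs * c + sum xs
sum-map-+ˡ c [] = refl
sum-map-+ˡ c (x ∷ xs) = trans (cong (c + x +_) (sum-map-+ˡ c xs)) (regroup c x (length xs * c) (sum xs))
  where regroup : ∀ c x L S → c + x + (L + S) ≡ c + L + (x + S)
        regroup = ℕ-solve-∀

length≡sum-map-1 : ∀ {A : Set} (xs : List A) → length xs ≡ sum (map (λ _ → 1) xs)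
length≡sum-map-1 xs = sym (trans (sum-map-const 1 xs) (ℕP.*-identityʳ (length xs)))

length-concatMap : ∀ {A B : Set} (g : A → List B) xs → length (concatMap g xs) ≡ sum (map (length ∘ g) xs)
length-concatMap g [] = refl
length-concatMap g (x ∷ xs) = trans (length-++ (g x)) (cong (length (g x) +_) (length-concatMap g xs))

-- Generating function of the number of solutions

module _ (a : ℕ) (as : List ℕ) where

  private
    term : ℕ → ℕ → ℕ
    term t x = iverson (x * a ≤? t) (solutions as (t ∸ x * a))

  solutions-∷ : ∀ t → solutions (a ∷ as) t ≡ ℕΣ.∑< (suc t) (term t)
  solutions-∷ t = trans (sum-map-filter (λ x → x * a ≤? t) (λ x → solutions as (t ∸ x * a)) (upTo (suc t)))
                        (ℕΣ.foldr-applyUpTo (term t) (λ x → x) (suc t))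

  module _ (a>0 : 0 < a) where

    solutions-∷-below : ∀ t → t < a → solutions (a ∷ as) t ≡ solutions as t
    solutions-∷-below t t<a = begin
      solutions (a ∷ as) t                          ≡⟨ solutions-∷ t ⟩
      term t 0 + ℕΣ.∑< t (term t ∘ suc)             ≡⟨ cong₂ _+_ (iverson-yes (0 ≤? t) z≤n _) (ℕΣ.∑<-zero t (λ x _ → iverson-no (suc x * a ≤? t) (too-big x) _)) ⟩
      solutions as t + 0                            ≡⟨ ℕP.+-identityʳ _ ⟩
      solutions as t                                ∎
      where
      open ≡-Reasoning
      too-big : ∀ x → ¬ suc x * a ≤ t
      too-big x le = ℕP.<⇒≱ t<a (ℕP.≤-trans (ℕP.m≤m+n a (x * a)) le)

    solutions-∷-offset : ∀ t → solutions (a ∷ as) (a + t) ≡ solutions as (a + t) + solutions (a ∷ as) t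
    solutions-∷-offset t = begin
      solutions (a ∷ as) (a + t)                                   ≡⟨ solutions-∷ (a + t) ⟩
      term (a + t) 0 + ℕΣ.∑< (a + t) (term (a + t) ∘ suc)          ≡⟨ cong₂ _+_ (iverson-yes (0 ≤? a + t) z≤n _) (ℕΣ.∑<-cong (a + t) (λ x _ → shift x)) ⟩
      solutions as (a + t) + ℕΣ.∑< (a + t) (term t)                ≡⟨ cong (solutions as (a + t) +_) (ℕΣ.∑<-extend (suc t) (a + t) (ℕP.+-monoˡ-≤ t a>0) beyond) ⟩
      solutions as (a + t) + ℕΣ.∑< (suc t) (term t)                ≡⟨ cong (solutions as (a + t) +_) (solutions-∷ t) ⟨
      solutions as (a + t) + solutions (a ∷ as) t                  ∎
      where
      open ≡-Reasoning
      shift : ∀ x → term (a + t) (suc x) ≡ term t x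
      shift x = trans (cong (iverson (suc x * a ≤? a + t)) (cong (solutions as) (ℕP.[m+n]∸[m+o]≡n∸o a t (x * a))))
                      (iverson-cong (suc x * a ≤? a + t) (x * a ≤? t) (ℕP.+-cancelˡ-≤ a _ _) (ℕP.+-monoʳ-≤ a) _)
      beyond : ∀ x → suc t ≤ x → term t x ≡ 0
      beyond x t<x = iverson-no (x * a ≤? t) (λ xa≤t → ℕP.<⇒≱ t<x (ℕP.≤-trans (ℕP.m≤m*n x a) xa≤t)) _
        where instance _ = >-nonZero a>0

solutionSeries : List ℕ → PS
solutionSeries as t = ℤ.+ solutions as t

solutionSeries-[] : solutionSeries [] ≈ₚ psOne
solutionSeries-[] zero = sym (xPow-diag 0)
solutionSeries-[] (suc m) = sym (xPow-off {0} {suc m} (λ ()))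

oneMinusXPow-⊛-solutionSeries : ∀ a as → 0 < a → oneMinusXPow a ⊛ solutionSeries (a ∷ as) ≈ₚ solutionSeries as
oneMinusXPow-⊛-solutionSeries a as a>0 m with split a m
... | below m<a = trans (oneMinusXPow-⊛-below a S m m<a) (cong ℤ.+_ (solutions-∷-below a as a>0 m m<a))
  where S = solutionSeries (a ∷ as)
... | offset m′ refl = begin
  (oneMinusXPow a ⊛ S) (a + m′)                               ≡⟨ oneMinusXPow-⊛-offset a S m′ ⟩
  S (a + m′) ℤ.- S m′                                         ≡⟨ cong (ℤ._- S m′) (cong ℤ.+_ (solutions-∷-offset a as a>0 m′)) ⟩
  ℤ.+ (solutions as (a + m′) + solutions (a ∷ as) m′) ℤ.- S m′ ≡⟨ cong (ℤ._- S m′) (ℤP.pos-+ (solutions as (a + m′)) (solutions (a ∷ as) m′)) ⟩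
  solutionSeries as (a + m′) ℤ.+ S m′ ℤ.- S m′                 ≡⟨ cancel (solutionSeries as (a + m′)) (S m′) ⟩
  solutionSeries as (a + m′)                                  ∎
  where open ≡-Reasoning
        S = solutionSeries (a ∷ as)
        cancel : ∀ x y → x ℤ.+ y ℤ.- y ≡ x
        cancel = ℤ-solve-∀

∏oneMinusXPow-⊛-solutionSeries : ∀ as → All (0 <_) as → psProd (map oneMinusXPow as) ⊛ solutionSeries as ≈ₚ psOne
∏oneMinusXPow-⊛-solutionSeries [] [] = ≈ₚ-trans (⊛-identityˡ (solutionSeries [])) solutionSeries-[]
∏oneMinusXPow-⊛-solutionSeries (a ∷ as) (a>0 ∷ as>0) = begin
  (oneMinusXPow a ⊛ Π) ⊛ solutionSeries (a ∷ as)       ≈⟨ ⊛-congˡ (solutionSeries (a ∷ as)) (⊛-comm (oneMinusXPow a) Π) ⟩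
  (Π ⊛ oneMinusXPow a) ⊛ solutionSeries (a ∷ as)       ≈⟨ ⊛-assoc Π (oneMinusXPow a) (solutionSeries (a ∷ as)) ⟩
  Π ⊛ (oneMinusXPow a ⊛ solutionSeries (a ∷ as))       ≈⟨ ⊛-congʳ Π (oneMinusXPow-⊛-solutionSeries a as a>0) ⟩
  Π ⊛ solutionSeries as                                ≈⟨ ∏oneMinusXPow-⊛-solutionSeries as as>0 ⟩
  psOne                                                ∎
  where open ≈ₚ-Reasoning
        Π = psProd (map oneMinusXPow as)

indicatorSeries-iverson : ∀ {P : Pred ℕ 0ℓ} (P? : Decidable P) t → indicatorSeries P? t ≡ ℤ.+ iverson (P? t) 1
indicatorSeries-iverson P? t with P? t
... | yes _ = refl
... | no _ = refl

binomial : ℕ → ℕ → ℕ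
binomial j m = (j + m) C m

binomial-zeroˡ : ∀ m → binomial 0 m ≡ 1
binomial-zeroˡ = nCn≡1

binomial-pascal : ∀ j m → binomial (suc j) (suc m) ≡ binomial (suc j) m + binomial j (suc m)
binomial-pascal j m = begin
  (suc j + suc m) C suc m                          ≡⟨ cong (_C suc m) (ℕP.+-suc (suc j) m) ⟩
  suc (suc j + m) C suc m                          ≡⟨ nCk+nC[k+1]≡[n+1]C[k+1] (suc j + m) m ⟨
  (suc j + m) C m + (suc j + m) C suc m            ≡⟨ cong (λ x → (suc j + m) C m + x C suc m) (ℕP.+-suc j m) ⟨
  (suc j + m) C m + (j + suc m) C suc m            ∎
  where open ≡-Reasoning

binomial-pos : ∀ j m → 0 < binomial j m
binomial-pos j zero = s≤s z≤n
binomial-pos zero (suc m) = subst (0 <_) (sym (binomial-zeroˡ (suc m))) (s≤s z≤n)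
binomial-pos (suc j) (suc m) =
  subst (0 <_) (sym (binomial-pascal j m)) (ℕP.<-≤-trans (binomial-pos (suc j) m) (ℕP.m≤m+n _ _))

binomial-<-suc : ∀ j m → binomial j (suc m) < binomial (suc j) (suc m)
binomial-<-suc j m =
  subst (binomial j (suc m) <_) (sym (binomial-pascal j m)) (ℕP.+-monoˡ-≤ (binomial j (suc m)) (binomial-pos (suc j) m))

binomial-strictMono : ∀ m {j j′} → j < j′ → binomial j (suc m) < binomial j′ (suc m)
binomial-strictMono m {j} {suc j′} (s≤s j≤j′) with ℕP.m≤n⇒m<n∨m≡n j≤j′
... | inj₁ j<j′ = ℕP.<-trans (binomial-strictMono m j<j′) (binomial-<-suc j′ m)
... | inj₂ refl = binomial-<-suc j m

binomial-mono-≤ : ∀ m {j j′} → j ≤ j′ → binomial j (suc m) ≤ binomial j′ (suc m)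
binomial-mono-≤ m j≤j′ with ℕP.m≤n⇒m<n∨m≡n j≤j′
... | inj₁ j<j′ = ℕP.<⇒≤ (binomial-strictMono m j<j′)
... | inj₂ refl = ℕP.≤-refl

binomial-cancel-≤ : ∀ m {j j′} → binomial j (suc m) ≤ binomial j′ (suc m) → j ≤ j′
binomial-cancel-≤ m {j} {j′} le with ℕP.≤-<-connex j j′
... | inj₁ j≤j′ = j≤j′
... | inj₂ j′<j = contradiction le (ℕP.<⇒≱ (binomial-strictMono m j′<j))

-- The series ∑ⱼ x^(j p) = 1/(1 - x^p) and its powers

module Multiples (p : ℕ) .{{_ : NonZero p}} where

  multiples : PS
  multiples = indicatorSeries (λ m → m % p ≟ 0)

  multiples-offset : ∀ m → multiples (p + m) ≡ multiples m
  multiples-offset m = begin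
    multiples (p + m)                       ≡⟨ indicatorSeries-iverson (λ m → m % p ≟ 0) (p + m) ⟩
    ℤ.+ iverson ((p + m) % p ≟ 0) 1          ≡⟨ cong ℤ.+_ (iverson-cong ((p + m) % p ≟ 0) (m % p ≟ 0) (trans (sym same-residue)) (trans same-residue) 1) ⟩
    ℤ.+ iverson (m % p ≟ 0) 1                ≡⟨ indicatorSeries-iverson (λ m → m % p ≟ 0) m ⟨
    multiples m                             ∎
    where
    open ≡-Reasoning
    same-residue : (p + m) % p ≡ m % p
    same-residue = trans (cong (_% p) (ℕP.+-comm p m)) ([m+n]%n≡m%n m p)

  oneMinusXPow-⊛-multiples : oneMinusXPow p ⊛ multiples ≈ₚ psOne
  oneMinusXPow-⊛-multiples m with split p m
  ... | below m<p = trans (oneMinusXPow-⊛-below p multiples m m<p) (below-p m m<p)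
    where
    below-p : ∀ m → m < p → multiples m ≡ psOne m
    below-p zero 0<p = trans (indicatorSeries-iverson (λ m → m % p ≟ 0) 0)
      (trans (cong ℤ.+_ (iverson-yes (0 % p ≟ 0) (m<n⇒m%n≡m 0<p) 1)) (sym (xPow-diag 0)))
    below-p (suc m) m<p = trans (indicatorSeries-iverson (λ m → m % p ≟ 0) (suc m))
      (trans (cong ℤ.+_ (iverson-no (suc m % p ≟ 0) (λ m%p≡0 → ℕP.1+n≢0 (trans (sym (m<n⇒m%n≡m m<p)) m%p≡0)) 1))
             (sym (xPow-off {0} {suc m} (λ ()))))
  ... | offset m′ refl = begin
    (oneMinusXPow p ⊛ multiples) (p + m′)        ≡⟨ oneMinusXPow-⊛-offset p multiples m′ ⟩
    multiples (p + m′) ℤ.- multiples m′          ≡⟨ cong (ℤ._- multiples m′) (multiples-offset m′) ⟩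
    multiples m′ ℤ.- multiples m′                ≡⟨ ℤP.+-inverseʳ (multiples m′) ⟩
    0ℤ                                          ≡⟨ xPow-off (ℕP.<⇒≢ (ℕP.<-≤-trans (>-nonZero⁻¹ p) (ℕP.m≤m+n p m′)) ∘ sym) ⟨
    psOne (p + m′)                              ∎
    where open ≡-Reasoning

  multiples^ : ℕ → PS
  multiples^ = psPow multiples

  oneMinusXPow-⊛-multiples^ : ∀ k → oneMinusXPow p ⊛ multiples^ (suc k) ≈ₚ multiples^ k
  oneMinusXPow-⊛-multiples^ k = begin
    oneMinusXPow p ⊛ (multiples ⊛ multiples^ k)    ≈⟨ ⊛-assoc (oneMinusXPow p) multiples (multiples^ k) ⟨
    (oneMinusXPow p ⊛ multiples) ⊛ multiples^ k    ≈⟨ ⊛-congˡ (multiples^ k) oneMinusXPow-⊛-multiples ⟩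
    psOne ⊛ multiples^ k                           ≈⟨ ⊛-identityˡ (multiples^ k) ⟩
    multiples^ k                                   ∎
    where open ≈ₚ-Reasoning

  oneMinusXPow^-⊛-multiples^ : ∀ k → psPow (oneMinusXPow p) k ⊛ multiples^ k ≈ₚ psOne
  oneMinusXPow^-⊛-multiples^ zero = ⊛-identityˡ psOne
  oneMinusXPow^-⊛-multiples^ (suc k) = begin
    (oneMinusXPow p ⊛ psPow (oneMinusXPow p) k) ⊛ (multiples ⊛ multiples^ k)
      ≈⟨ ⊛-interchange (oneMinusXPow p) (psPow (oneMinusXPow p) k) multiples (multiples^ k) ⟩
    (oneMinusXPow p ⊛ multiples) ⊛ (psPow (oneMinusXPow p) k ⊛ multiples^ k)
      ≈⟨ ⊛-cong oneMinusXPow-⊛-multiples (oneMinusXPow^-⊛-multiples^ k) ⟩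
    psOne ⊛ psOne
      ≈⟨ ⊛-identityˡ psOne ⟩
    psOne ∎
    where open ≈ₚ-Reasoning

  multiples^-below : ∀ k m → m < p → multiples^ (suc k) m ≡ multiples^ k m
  multiples^-below k m m<p =
    trans (sym (oneMinusXPow-⊛-below p (multiples^ (suc k)) m m<p)) (oneMinusXPow-⊛-multiples^ k m)

  multiples^-offset : ∀ k m → multiples^ (suc k) (p + m) ≡ multiples^ k (p + m) ℤ.+ multiples^ (suc k) m
  multiples^-offset k m = begin
    M₊ (p + m)                                   ≡⟨ sub-add (M₊ (p + m)) (M₊ m) ⟩
    (M₊ (p + m) ℤ.- M₊ m) ℤ.+ M₊ m               ≡⟨ cong (ℤ._+ M₊ m) (oneMinusXPow-⊛-offset p M₊ m) ⟨
    (oneMinusXPow p ⊛ M₊) (p + m) ℤ.+ M₊ m       ≡⟨ cong (ℤ._+ M₊ m) (oneMinusXPow-⊛-multiples^ k (p + m)) ⟩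
    multiples^ k (p + m) ℤ.+ M₊ m                ∎
    where
    open ≡-Reasoning
    M₊ = multiples^ (suc k)
    sub-add : ∀ x y → x ≡ (x ℤ.- y) ℤ.+ y
    sub-add = ℤ-solve-∀

  multiples^-zero : ∀ k → multiples^ k 0 ≡ 1ℤ
  multiples^-zero zero = xPow-diag 0
  multiples^-zero (suc k) = trans (multiples^-below k 0 (>-nonZero⁻¹ p)) (multiples^-zero k)

  private
    non-multiple : ∀ k j u → 0 < u → u < p → multiples^ k (u + j * p) ≡ 0ℤ
    non-multiple zero j u u>0 u<p = xPow-off (ℕP.<⇒≢ (ℕP.<-≤-trans u>0 (ℕP.m≤m+n u _)) ∘ sym)
    non-multiple (suc k) zero u u>0 u<p =
      trans (multiples^-below k (u + 0) (subst (_< p) (sym (ℕP.+-identityʳ u)) u<p)) (non-multiple k zero u u>0 u<p)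
    non-multiple (suc k) (suc j) u u>0 u<p = begin
      multiples^ (suc k) (u + suc j * p)                                  ≡⟨ cong (multiples^ (suc k)) rearrange ⟩
      multiples^ (suc k) (p + (u + j * p))                                ≡⟨ multiples^-offset k (u + j * p) ⟩
      multiples^ k (p + (u + j * p)) ℤ.+ multiples^ (suc k) (u + j * p)    ≡⟨ cong₂ ℤ._+_ (trans (cong (multiples^ k) (sym rearrange)) (non-multiple k (suc j) u u>0 u<p)) (non-multiple (suc k) j u u>0 u<p) ⟩
      0ℤ                                                                  ∎
      where
      open ≡-Reasoning
      rearrange : u + suc j * p ≡ p + (u + j * p)
      rearrange = trans (sym (ℕP.+-assoc u p _)) (trans (cong (_+ j * p) (ℕP.+-comm u p)) (ℕP.+-assoc p u _))

  multiples^-non-multiple : ∀ k x → x % p ≢ 0 → multiples^ k x ≡ 0ℤ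
  multiples^-non-multiple k x x%p≢0 =
    trans (cong (multiples^ k) (m≡m%n+[m/n]*n x p)) (non-multiple k (x / p) (x % p) (ℕP.n≢0⇒n>0 x%p≢0) (m%n<n x p))

  multiples^-multiple : ∀ m j → multiples^ (suc m) (j * p) ≡ ℤ.+ binomial j m
  multiples^-multiple zero zero = multiples^-zero 1
  multiples^-multiple (suc m) zero = trans (multiples^-zero (suc (suc m))) (cong ℤ.+_ (sym (binomial-zeroˡ (suc m))))
  multiples^-multiple zero (suc j) = begin
    multiples^ 1 (p + j * p)                         ≡⟨ multiples^-offset zero (j * p) ⟩
    psOne (p + j * p) ℤ.+ multiples^ 1 (j * p)        ≡⟨ cong₂ ℤ._+_ (xPow-off (ℕP.<⇒≢ (ℕP.<-≤-trans (>-nonZero⁻¹ p) (ℕP.m≤m+n p _)) ∘ sym)) (multiples^-multiple zero j) ⟩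
    0ℤ ℤ.+ ℤ.+ 1                                     ≡⟨ ℤP.+-identityˡ _ ⟩
    ℤ.+ 1                                           ∎
    where open ≡-Reasoning
  multiples^-multiple (suc m) (suc j) = begin
    multiples^ (suc (suc m)) (p + j * p)                                  ≡⟨ multiples^-offset (suc m) (j * p) ⟩
    multiples^ (suc m) (p + j * p) ℤ.+ multiples^ (suc (suc m)) (j * p)    ≡⟨ cong₂ ℤ._+_ (multiples^-multiple m (suc j)) (multiples^-multiple (suc m) j) ⟩
    ℤ.+ binomial (suc j) m ℤ.+ ℤ.+ binomial j (suc m)                       ≡⟨ ℤP.pos-+ (binomial (suc j) m) (binomial j (suc m)) ⟨
    ℤ.+ (binomial (suc j) m + binomial j (suc m))                          ≡⟨ cong ℤ.+_ (binomial-pascal j m) ⟨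
    ℤ.+ binomial (suc j) (suc m)                                          ∎
    where open ≡-Reasoning

-- Multiplicities in lists of naturals

occ : ℕ → List ℕ → ℕ
occ m [] = 0
occ m (x ∷ xs) = iverson (m ≟ x) 1 + occ m xs

occ-++ : ∀ m xs ys → occ m (xs ++ ys) ≡ occ m xs + occ m ys
occ-++ m [] ys = refl
occ-++ m (x ∷ xs) ys = trans (cong (iverson (m ≟ x) 1 +_) (occ-++ m xs ys)) (sym (ℕP.+-assoc (iverson (m ≟ x) 1) _ _))

occ-map-+-offset : ∀ c m xs → occ (c + m) (map (c +_) xs) ≡ occ m xs
occ-map-+-offset c m [] = refl
occ-map-+-offset c m (x ∷ xs) =
  cong₂ _+_ (iverson-cong (c + m ≟ c + x) (m ≟ x) (ℕP.+-cancelˡ-≡ c m x) (cong (c +_)) 1) (occ-map-+-offset c m xs)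

occ-map-+-below : ∀ c m xs → m < c → occ m (map (c +_) xs) ≡ 0
occ-map-+-below c m [] _ = refl
occ-map-+-below c m (x ∷ xs) m<c =
  cong₂ _+_ (iverson-no (m ≟ c + x) (λ m≡c+x → ℕP.<⇒≱ m<c (subst (c ≤_) (sym m≡c+x) (ℕP.m≤m+n c x))) 1)
            (occ-map-+-below c m xs m<c)

∉⇒occ≡0 : ∀ {m} xs → m ∉ xs → occ m xs ≡ 0
∉⇒occ≡0 [] _ = refl
∉⇒occ≡0 {m} (x ∷ xs) m∉ = cong₂ _+_ (iverson-no (m ≟ x) (m∉ ∘ here) 1) (∉⇒occ≡0 xs (m∉ ∘ there))

occ>0⇒∈ : ∀ {m} xs → 0 < occ m xs → m ∈ xs
occ>0⇒∈ {m} (x ∷ xs) occ>0 = case m ≟ x of λ where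
  (yes m≡x) → here m≡x
  (no m≢x) → there (occ>0⇒∈ xs (subst (λ v → 0 < v + occ m xs) (iverson-no (m ≟ x) m≢x 1) occ>0))

occ-unique : ∀ {m} xs → Unique xs → occ m xs ≤ 1
occ-unique [] [] = z≤n
occ-unique {m} (x ∷ xs) (x∉xs ∷ xs!) = case m ≟ x of λ where
  (yes refl) → ℕP.≤-reflexive (cong₂ _+_ (iverson-yes (m ≟ m) refl 1) (∉⇒occ≡0 xs (λ m∈xs → All.lookup x∉xs m∈xs refl)))
  (no m≢x) → subst (λ v → v + occ m xs ≤ 1) (sym (iverson-no (m ≟ x) m≢x 1)) (occ-unique xs xs!)

∈-unique⇒occ≡1 : ∀ {m} xs → Unique xs → m ∈ xs → occ m xs ≡ 1
∈-unique⇒occ≡1 xs xs! m∈xs = ℕP.≤-antisym (occ-unique xs xs!) (occ∈ xs m∈xs)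
  where
  occ∈ : ∀ {m} xs → m ∈ xs → 0 < occ m xs
  occ∈ {m} (x ∷ xs) (here refl) = subst (λ v → 0 < v + occ m xs) (sym (iverson-yes (m ≟ m) refl 1)) (s≤s z≤n)
  occ∈ {m} (x ∷ xs) (there m∈xs) = ℕP.<-≤-trans (occ∈ xs m∈xs) (ℕP.m≤n+m _ (iverson (m ≟ x) 1))

occ-concatMap : ∀ {A : Set} t (g : A → List ℕ) xs → occ t (concatMap g xs) ≡ sum (map (occ t ∘ g) xs)
occ-concatMap t g [] = refl
occ-concatMap t g (x ∷ xs) = trans (occ-++ t (g x) (concatMap g xs)) (cong (occ t (g x) +_) (occ-concatMap t g xs))

listSeries : List ℕ → PS
listSeries xs m = ℤ.+ occ m xs

listSeries-++ : ∀ xs ys → listSeries (xs ++ ys) ≈ₚ listSeries xs ⊕ listSeries ys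
listSeries-++ xs ys m = trans (cong ℤ.+_ (occ-++ m xs ys)) (ℤP.pos-+ (occ m xs) (occ m ys))

listSeries-map-+ : ∀ c xs → listSeries (map (c +_) xs) ≈ₚ xPow c ⊛ listSeries xs
listSeries-map-+ c xs = ≈ₚ-xPow-⊛ c (listSeries (map (c +_) xs)) (listSeries xs)
  (λ m m<c → cong ℤ.+_ (occ-map-+-below c m xs m<c)) (λ m → cong ℤ.+_ (occ-map-+-offset c m xs))

listSeries-[0] : listSeries (0 ∷ []) ≈ₚ psOne
listSeries-[0] zero = refl
listSeries-[0] (suc m) = refl

shifts : ℕ → ℕ → List ℕ → List ℕ
shifts a zero xs = []
shifts a (suc d) xs = xs ++ map (a +_) (shifts a d xs)

geom-⊛-listSeries : ∀ a d xs → geom a d ⊛ listSeries xs ≈ₚ listSeries (shifts a d xs)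
geom-⊛-listSeries a zero xs = ⊛-zeroˡ (listSeries xs)
geom-⊛-listSeries a (suc d) xs = begin
  (psOne ⊕ xPow a ⊛ geom a d) ⊛ listSeries xs                    ≈⟨ ⊛-distribʳ-⊕ psOne (xPow a ⊛ geom a d) (listSeries xs) ⟩
  psOne ⊛ listSeries xs ⊕ (xPow a ⊛ geom a d) ⊛ listSeries xs    ≈⟨ (λ m → cong₂ ℤ._+_ (⊛-identityˡ (listSeries xs) m) (⊛-assoc (xPow a) (geom a d) (listSeries xs) m)) ⟩
  listSeries xs ⊕ xPow a ⊛ (geom a d ⊛ listSeries xs)            ≈⟨ (λ m → cong (ℤ._+_ (listSeries xs m)) (⊛-congʳ (xPow a) (geom-⊛-listSeries a d xs) m)) ⟩
  listSeries xs ⊕ xPow a ⊛ listSeries (shifts a d xs)            ≈⟨ (λ m → cong (ℤ._+_ (listSeries xs m)) (listSeries-map-+ a (shifts a d xs) m)) ⟨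
  listSeries xs ⊕ listSeries (map (a +_) (shifts a d xs))        ≈⟨ listSeries-++ xs (map (a +_) (shifts a d xs)) ⟨
  listSeries (shifts a (suc d) xs)                               ∎
  where open ≈ₚ-Reasoning

∈-shifts⁻ : ∀ a d xs {z} → z ∈ shifts a d xs → ∃₂ λ r x → r < d × x ∈ xs × z ≡ r * a + x
∈-shifts⁻ a (suc d) xs z∈ with ∈-++⁻ xs z∈
... | inj₁ z∈xs = 0 , _ , s≤s z≤n , z∈xs , refl
... | inj₂ z∈map with ∈-map⁻ (a +_) z∈map
...   | z′ , z′∈ , refl with ∈-shifts⁻ a d xs z′∈
...     | r , x , r<d , x∈xs , refl = suc r , x , s≤s r<d , x∈xs , sym (ℕP.+-assoc a (r * a) x)

∈-shifts⁺ : ∀ a d xs {r x} → r < d → x ∈ xs → r * a + x ∈ shifts a d xs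
∈-shifts⁺ a (suc d) xs {zero} _ x∈xs = ∈-++⁺ˡ x∈xs
∈-shifts⁺ a (suc d) xs {suc r} {x} (s≤s r<d) x∈xs =
  ∈-++⁺ʳ xs (subst (_∈ map (a +_) (shifts a d xs)) (sym (ℕP.+-assoc a (r * a) x)) (∈-map⁺ (a +_) (∈-shifts⁺ a d xs r<d x∈xs)))

length-shifts : ∀ a d xs → length (shifts a d xs) ≡ d * length xs
length-shifts a zero xs = refl
length-shifts a (suc d) xs =
  trans (length-++ xs) (cong (length xs +_) (trans (length-map (a +_) (shifts a d xs)) (length-shifts a d xs)))

sum-shifts : ∀ a d xs → 2 * sum (shifts a (suc d) xs) ≡ suc d * (2 * sum xs + d * a * length xs)
sum-shifts a zero xs = trans (cong (2 *_) (trans (sum-++ xs []) (ℕP.+-identityʳ _))) (base (sum xs) (a * length xs))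
  where base : ∀ S x → 2 * S ≡ 1 * (2 * S + 0 * x)
        base = ℕ-solve-∀
sum-shifts a (suc d) xs = begin
  2 * sum (xs ++ map (a +_) E)                              ≡⟨ cong (2 *_) (trans (sum-++ xs _) (cong (sum xs +_) (sum-map-+ˡ a E))) ⟩
  2 * (sum xs + (length E * a + sum E))                     ≡⟨ cong (λ l → 2 * (sum xs + (l * a + sum E))) (length-shifts a (suc d) xs) ⟩
  2 * (sum xs + (suc d * length xs * a + sum E))            ≡⟨ split-2 (sum xs) (suc d * length xs * a) (sum E) ⟩
  2 * sum xs + 2 * (suc d * length xs * a) + 2 * sum E      ≡⟨ cong (2 * sum xs + 2 * (suc d * length xs * a) +_) (sum-shifts a d xs) ⟩
  2 * sum xs + 2 * (suc d * length xs * a) + suc d * (2 * sum xs + d * a * length xs) ≡⟨ collect a d (sum xs) (length xs) ⟩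
  suc (suc d) * (2 * sum xs + suc d * a * length xs)        ∎
  where
  open ≡-Reasoning
  E = shifts a (suc d) xs
  split-2 : ∀ x y z → 2 * (x + (y + z)) ≡ 2 * x + 2 * y + 2 * z
  split-2 = ℕ-solve-∀
  collect : ∀ a d S L → 2 * S + 2 * (suc d * L * a) + suc d * (2 * S + d * a * L) ≡ suc (suc d) * (2 * S + suc d * a * L)
  collect = ℕ-solve-∀

∑<-occ : ∀ N (w : ℕ → ℕ) ys → All (_< N) ys → ℕΣ.∑< N (λ u → occ u ys * w u) ≡ sum (map w ys)
∑<-occ N w [] [] = ℕΣ.∑<-zero N (λ _ _ → refl)
∑<-occ N w (y ∷ ys) (y<N ∷ ys<N) = begin
  ℕΣ.∑< N (λ u → (iverson (u ≟ y) 1 + occ u ys) * w u)                            ≡⟨ ℕΣ.∑<-cong N (λ u _ → ℕP.*-distribʳ-+ (w u) (iverson (u ≟ y) 1) (occ u ys)) ⟩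
  ℕΣ.∑< N (λ u → iverson (u ≟ y) 1 * w u + occ u ys * w u)                        ≡⟨ ℕΣ.∑<-distrib (λ u → iverson (u ≟ y) 1 * w u) (λ u → occ u ys * w u) N ⟩
  ℕΣ.∑< N (λ u → iverson (u ≟ y) 1 * w u) + ℕΣ.∑< N (λ u → occ u ys * w u)        ≡⟨ cong₂ _+_ only-y (∑<-occ N w ys ys<N) ⟩
  w y + sum (map w ys)                                                           ∎
  where
  open ≡-Reasoning
  only-y : ℕΣ.∑< N (λ u → iverson (u ≟ y) 1 * w u) ≡ w y
  only-y = trans (ℕΣ.∑<-single N y y<N (λ u _ u≢y → cong (_* w u) (iverson-no (u ≟ y) u≢y 1)))
                 (trans (cong (_* w y) (iverson-yes (y ≟ y) refl 1)) (ℕP.*-identityˡ (w y)))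

module _ {P : Pred ℕ 0ℓ} (P? : Decidable P) (B : ℕ) (L : List ℕ) (L<B : All (_< B) L)
         (P≡occ : ∀ t → t < B → iverson (P? t) 1 ≡ occ t L) where

  countBelow-occ : countBelow P? B ≡ length L
  countBelow-occ = begin
    length (filter P? (upTo B))                          ≡⟨ length≡sum-map-1 (filter P? (upTo B)) ⟩
    sum (map (λ _ → 1) (filter P? (upTo B)))             ≡⟨ sum-map-filter P? (λ _ → 1) (upTo B) ⟩
    sum (map (λ t → iverson (P? t) 1) (upTo B))          ≡⟨ ℕΣ.foldr-applyUpTo (λ t → iverson (P? t) 1) (λ t → t) B ⟩
    ℕΣ.∑< B (λ t → iverson (P? t) 1)                     ≡⟨ ℕΣ.∑<-cong B (λ t t<B → trans (P≡occ t t<B) (sym (ℕP.*-identityʳ _))) ⟩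
    ℕΣ.∑< B (λ t → occ t L * 1)                          ≡⟨ ∑<-occ B (λ _ → 1) L L<B ⟩
    sum (map (λ _ → 1) L)                                ≡⟨ length≡sum-map-1 L ⟨
    length L                                             ∎
    where open ≡-Reasoning

  sumBelow-occ : sumBelow P? B ≡ sum L
  sumBelow-occ = begin
    sum (filter P? (upTo B))                             ≡⟨ cong sum (map-id (filter P? (upTo B))) ⟨
    sum (map (λ t → t) (filter P? (upTo B)))             ≡⟨ sum-map-filter P? (λ t → t) (upTo B) ⟩
    sum (map (λ t → iverson (P? t) t) (upTo B))          ≡⟨ ℕΣ.foldr-applyUpTo (λ t → iverson (P? t) t) (λ t → t) B ⟩
    ℕΣ.∑< B (λ t → iverson (P? t) t)                     ≡⟨ ℕΣ.∑<-cong B (λ t t<B → trans (iverson-scale (P? t) t) (cong (_* t) (P≡occ t t<B))) ⟩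
    ℕΣ.∑< B (λ t → occ t L * t)                          ≡⟨ ∑<-occ B (λ t → t) L L<B ⟩
    sum (map (λ t → t) L)                                ≡⟨ cong sum (map-id L) ⟩
    sum L                                                ∎
    where
    open ≡-Reasoning
    iverson-scale : ∀ {Q : Set} (Q? : Dec Q) v → iverson Q? v ≡ iverson Q? 1 * v
    iverson-scale (yes _) v = sym (ℕP.*-identityˡ v)
    iverson-scale (no _) v = refl

∑<-≤ : ∀ (c : ℕ → ℕ) N → (∀ u → u < N → c u ≤ 1) → ℕΣ.∑< N c ≤ N
∑<-≤ c zero _ = z≤n
∑<-≤ c (suc N) c≤1 = ℕP.+-mono-≤ (c≤1 0 (s≤s z≤n)) (∑<-≤ (c ∘ suc) N (λ u u<N → c≤1 (suc u) (s≤s u<N)))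

pigeonhole : ∀ (c : ℕ → ℕ) N → ℕΣ.∑< N c ≡ N → (∀ u → u < N → c u ≤ 1) → ∀ u → u < N → c u ≡ 1
pigeonhole c (suc N) ∑≡N c≤1 u u<N with c 0 in c0≡ | c≤1 0 (s≤s z≤n)
... | zero | _ = contradiction (subst (_≤ N) ∑≡N (∑<-≤ (c ∘ suc) N (λ u u<N → c≤1 (suc u) (s≤s u<N)))) ℕP.1+n≰n
... | suc (suc _) | s≤s ()
... | suc zero | _ with u | u<N
...   | zero | _ = c0≡
...   | suc u′ | s≤s u′<N = pigeonhole (c ∘ suc) N (ℕP.suc-injective ∑≡N) (λ u u<N → c≤1 (suc u) (s≤s u<N)) u′ u′<N

2*∑<-id+n≡n*n : ∀ N → 2 * ℕΣ.∑< N (λ u → u) + N ≡ N * N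
2*∑<-id+n≡n*n zero = refl
2*∑<-id+n≡n*n (suc N) = begin
  2 * ℕΣ.∑< (suc N) (λ u → u) + suc N          ≡⟨ cong (λ S → 2 * S + suc N) (ℕΣ.∑<-snoc (λ u → u) N) ⟩
  2 * (ℕΣ.∑< N (λ u → u) + N) + suc N          ≡⟨ regroup (ℕΣ.∑< N (λ u → u)) N ⟩
  (2 * ℕΣ.∑< N (λ u → u) + N) + (2 * N + 1)    ≡⟨ cong (_+ (2 * N + 1)) (2*∑<-id+n≡n*n N) ⟩
  N * N + (2 * N + 1)                          ≡⟨ square N ⟩
  suc N * suc N                                ∎
  where
  open ≡-Reasoning
  regroup : ∀ S N → 2 * (S + N) + suc N ≡ (2 * S + N) + (2 * N + 1)
  regroup = ℕ-solve-∀
  square : ∀ N → N * N + (2 * N + 1) ≡ suc N * suc N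
  square = ℕ-solve-∀

-- Residues

module _ {M : ℕ} .{{_ : NonZero M}} where

  %-≡⇒∣-offset : ∀ x z → x % M ≡ (x + z) % M → M ∣ z
  %-≡⇒∣-offset x z x≡x+z = divides ((x + z) / M ∸ x / M) (begin
    z                                              ≡⟨ ℕP.m+n∸m≡n x z ⟨
    x + z ∸ x                                      ≡⟨ cong₂ _∸_ (m≡m%n+[m/n]*n (x + z) M) (m≡m%n+[m/n]*n x M) ⟩
    (x + z) % M + (x + z) / M * M ∸ (x % M + x / M * M) ≡⟨ cong (λ r → r + (x + z) / M * M ∸ (x % M + x / M * M)) x≡x+z ⟨
    x % M + (x + z) / M * M ∸ (x % M + x / M * M)  ≡⟨ ℕP.[m+n]∸[m+o]≡n∸o (x % M) _ _ ⟩
    (x + z) / M * M ∸ x / M * M                    ≡⟨ ℕP.*-distribʳ-∸ M ((x + z) / M) (x / M) ⟨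
    ((x + z) / M ∸ x / M) * M                      ∎)
    where open ≡-Reasoning

  %-≡⇒offset-multiple : ∀ {r t} → r % M ≡ t % M → r ≤ t → ∃ λ j → t ≡ r + j * M
  %-≡⇒offset-multiple {r} {t} r≡t r≤t with %-≡⇒∣-offset r (t ∸ r) (trans r≡t (cong (_% M) (sym (ℕP.m+[n∸m]≡n r≤t))))
  ... | divides j t∸r≡j*M = j , trans (sym (ℕP.m+[n∸m]≡n r≤t)) (cong (r +_) t∸r≡j*M)

  private
    %-cancel-+ˡ-≤ : ∀ c {y y′} → y ≤ y′ → (c + y) % M ≡ (c + y′) % M → y % M ≡ y′ % M
    %-cancel-+ˡ-≤ c {y} {y′} y≤y′ eq = sym (begin
      y′ % M                  ≡⟨ cong (_% M) (ℕP.m+[n∸m]≡n y≤y′) ⟨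
      (y + (y′ ∸ y)) % M      ≡⟨ %-remove-+ʳ y (%-≡⇒∣-offset (c + y) (y′ ∸ y) (trans eq (cong (_% M) regroup))) ⟩
      y % M                   ∎)
      where
      open ≡-Reasoning
      regroup : c + y′ ≡ c + y + (y′ ∸ y)
      regroup = trans (cong (c +_) (sym (ℕP.m+[n∸m]≡n y≤y′))) (sym (ℕP.+-assoc c y _))

  %-cancel-+ˡ : ∀ c y y′ → (c + y) % M ≡ (c + y′) % M → y % M ≡ y′ % M
  %-cancel-+ˡ c y y′ eq with ℕP.≤-total y y′
  ... | inj₁ y≤y′ = %-cancel-+ˡ-≤ c y≤y′ eq
  ... | inj₂ y′≤y = sym (%-cancel-+ˡ-≤ c y′≤y (sym eq))

%-≡-∣ : ∀ {M N} .{{_ : NonZero M}} .{{_ : NonZero N}} → N ∣ M → ∀ x y → x % M ≡ y % M → x % N ≡ y % N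
%-≡-∣ {M} {N} N∣M x y eq = trans (sym (m∣n⇒o%n%m≡o%m N M x N∣M)) (trans (cong (_% N) eq) (m∣n⇒o%n%m≡o%m N M y N∣M))

∣-<⇒≡0 : ∀ {D n} → D ∣ n → n < D → n ≡ 0
∣-<⇒≡0 {n = zero} _ _ = refl
∣-<⇒≡0 {n = suc n} D∣n n<D = contradiction (∣⇒≤ D∣n) (ℕP.<⇒≱ n<D)

module _ {D a : ℕ} .{{_ : NonZero D}} (D⊥a : Coprime D a) where

  private
    ≤-residue-*-injective : ∀ {r r′} → r ≤ r′ → r′ < D → (r * a) % D ≡ (r′ * a) % D → r ≡ r′
    ≤-residue-*-injective {r} {r′} r≤r′ r′<D eq = ℕP.≤-antisym r≤r′ (ℕP.m∸n≡0⇒m≤n r′∸r≡0)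
      where
      D∣[r′∸r]*a : D ∣ (r′ ∸ r) * a
      D∣[r′∸r]*a = %-≡⇒∣-offset (r * a) ((r′ ∸ r) * a)
        (trans eq (cong (_% D) (trans (cong (_* a) (sym (ℕP.m+[n∸m]≡n r≤r′))) (ℕP.*-distribʳ-+ a r (r′ ∸ r)))))
      r′∸r≡0 : r′ ∸ r ≡ 0
      r′∸r≡0 = ∣-<⇒≡0 (coprime-divisor D⊥a (subst (D ∣_) (ℕP.*-comm (r′ ∸ r) a) D∣[r′∸r]*a))
                      (ℕP.≤-<-trans (ℕP.m∸n≤m r′ r) r′<D)

  residue-*-injective : ∀ {r r′} → r < D → r′ < D → (r * a) % D ≡ (r′ * a) % D → r ≡ r′
  residue-*-injective {r} {r′} r<D r′<D eq with ℕP.≤-total r r′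
  ... | inj₁ r≤r′ = ≤-residue-*-injective r≤r′ r′<D eq
  ... | inj₂ r′≤r = sym (≤-residue-*-injective r′≤r r<D (sym eq))

  residue-*-+-injective : ∀ {r r′ y y′} → r < D → r′ < D → D ∣ y → D ∣ y′ →
                          (r * a + y) % D ≡ (r′ * a + y′) % D → r ≡ r′
  residue-*-+-injective {r} {r′} r<D r′<D D∣y D∣y′ eq =
    residue-*-injective r<D r′<D (trans (sym (%-remove-+ʳ (r * a) D∣y)) (trans eq (%-remove-+ʳ (r′ * a) D∣y′)))

DistinctMod : (M : ℕ) .{{_ : NonZero M}} → List ℕ → Set
DistinctMod M = AllPairs (λ x y → x % M ≢ y % M)

module _ {M : ℕ} .{{_ : NonZero M}} where

  distinctMod⇒unique : ∀ {xs} → DistinctMod M xs → Unique xs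
  distinctMod⇒unique = AllPairs.map (λ x%≢y% x≡y → x%≢y% (cong (_% M) x≡y))

  distinctMod⇒unique-residues : ∀ {xs} → DistinctMod M xs → Unique (map (_% M) xs)
  distinctMod⇒unique-residues = AllPairs.map⁺

  distinctMod-≡ : ∀ {xs x y} → DistinctMod M xs → x ∈ xs → y ∈ xs → x % M ≡ y % M → x ≡ y
  distinctMod-≡ (_ ∷ _) (here refl) (here refl) _ = refl
  distinctMod-≡ (x≢ ∷ _) (here refl) (there y∈xs) eq = contradiction eq (All.lookup x≢ y∈xs)
  distinctMod-≡ (y≢ ∷ _) (there x∈xs) (here refl) eq = contradiction (sym eq) (All.lookup y≢ x∈xs)
  distinctMod-≡ (_ ∷ xs!) (there x∈xs) (there y∈xs) eq = distinctMod-≡ xs! x∈xs y∈xs eq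

  distinctMod-map-+ : ∀ c {xs} → DistinctMod M xs → DistinctMod M (map (c +_) xs)
  distinctMod-map-+ c = AllPairs.map⁺ ∘ AllPairs.map (λ {x} {y} x%≢y% eq → x%≢y% (%-cancel-+ˡ c x y eq))

  distinctMod-∣ : ∀ {N} .{{_ : NonZero N}} → M ∣ N → ∀ {xs} → DistinctMod M xs → DistinctMod N xs
  distinctMod-∣ M∣N = AllPairs.map (λ {x} {y} x%≢y% eq → x%≢y% (%-≡-∣ M∣N x y eq))

  module _ {xs : List ℕ} (xs! : DistinctMod M xs) (|xs|≡M : length xs ≡ M) where

    distinctMod-occ-residue : ∀ u → u < M → occ u (map (_% M) xs) ≡ 1
    distinctMod-occ-residue = pigeonhole (λ u → occ u residues) M ∑occ≡M (λ u _ → occ-unique residues (distinctMod⇒unique-residues xs!))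
      where
      residues = map (_% M) xs
      ∑occ≡M : ℕΣ.∑< M (λ u → occ u residues) ≡ M
      ∑occ≡M = begin
        ℕΣ.∑< M (λ u → occ u residues)        ≡⟨ ℕΣ.∑<-cong M (λ u _ → ℕP.*-identityʳ (occ u residues)) ⟨
        ℕΣ.∑< M (λ u → occ u residues * 1)    ≡⟨ ∑<-occ M (λ _ → 1) residues (All.map⁺ (All.tabulate (λ {x} _ → m%n<n x M))) ⟩
        sum (map (λ _ → 1) residues)          ≡⟨ length≡sum-map-1 residues ⟨
        length residues                       ≡⟨ length-map (_% M) xs ⟩
        length xs                             ≡⟨ |xs|≡M ⟩
        M                                     ∎
        where open ≡-Reasoning

    distinctMod-complete : ∀ t → ∃ λ R → R ∈ xs × R % M ≡ t % M
    distinctMod-complete t with ∈-map⁻ (_% M) (occ>0⇒∈ (map (_% M) xs) (ℕP.≤-reflexive (sym (distinctMod-occ-residue (t % M) (m%n<n t M)))))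
    ... | R , R∈xs , t%≡R% = R , R∈xs , sym t%≡R%

module _ {D M a : ℕ} .{{_ : NonZero D}} .{{_ : NonZero M}} .{{_ : NonZero (D * M)}} (D⊥a : Coprime D a) where

  shifts-distinctMod : ∀ {xs} → All (D ∣_) xs → DistinctMod M xs → ∀ d → d ≤ D → DistinctMod (D * M) (shifts a d xs)
  shifts-distinctMod _ _ zero _ = []
  shifts-distinctMod {xs} D∣xs xs! (suc d) d<D =
    AllPairs.++⁺ (distinctMod-∣ (n∣m*n D) xs!) (distinctMod-map-+ a (shifts-distinctMod D∣xs xs! d (ℕP.<⇒≤ d<D)))
                 (All.tabulate λ x∈xs → All.tabulate λ z∈ → apart x∈xs z∈)
    where
    apart : ∀ {x z} → x ∈ xs → z ∈ map (a +_) (shifts a d xs) → x % (D * M) ≢ z % (D * M)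
    apart {x} x∈xs z∈ eq with ∈-map⁻ (a +_) z∈
    ... | z′ , z′∈ , refl with ∈-shifts⁻ a d xs z′∈
    ...   | r , x′ , r<d , x′∈xs , refl = ℕP.0≢1+n (residue-*-+-injective D⊥a (ℕP.<-≤-trans (s≤s z≤n) d<D)
                                             (ℕP.<-≤-trans (s≤s r<d) d<D) (All.lookup D∣xs x∈xs) (All.lookup D∣xs x′∈xs)
                                             (%-≡-∣ (m∣m*n M) x (a + r * a + x′) (trans eq (cong (_% (D * M)) (sym (ℕP.+-assoc a (r * a) x′))))))

progression : ℕ → ℕ → ℕ → List ℕ
progression c M N = applyUpTo (λ i → c + i * M) N

module _ {M : ℕ} .{{_ : NonZero M}} where

  private
    progression-injective : ∀ c {i j} → c + i * M ≡ c + j * M → i ≡ j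
    progression-injective c {i} {j} eq = ℕP.*-cancelʳ-≡ i j M (ℕP.+-cancelˡ-≡ c _ _ eq)

    ≡%⇒≡+/ : ∀ {c} t → c ≡ t % M → t ≡ c + t / M * M
    ≡%⇒≡+/ t c≡t = trans (m≡m%n+[m/n]*n t M) (cong (_+ t / M * M) (sym c≡t))

  occ-progression-≢ : ∀ {c} N t → c < M → c ≢ t % M → occ t (progression c M N) ≡ 0
  occ-progression-≢ {c} N t c<M c≢t = ∉⇒occ≡0 (progression c M N) λ t∈ → case ∈-applyUpTo⁻ (λ i → c + i * M) t∈ of λ where
    (i , _ , refl) → c≢t (sym (trans ([m+kn]%n≡m%n c i M) (m<n⇒m%n≡m c<M)))

  occ-progression-≡ : ∀ {c} N t → c ≡ t % M → occ t (progression c M N) ≡ iverson (t / M <? N) 1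
  occ-progression-≡ {c} N t c≡t = case t / M <? N of λ where
    (yes t/M<N) → trans (∈-unique⇒occ≡1 (progression c M N) (applyUpTo⁺₁ (λ i → c + i * M) N (λ i<j _ → ℕP.<⇒≢ i<j ∘ progression-injective c))
                          (subst (_∈ progression c M N) (sym (≡%⇒≡+/ t c≡t)) (∈-applyUpTo⁺ (λ i → c + i * M) t/M<N)))
                        (sym (iverson-yes (t / M <? N) t/M<N 1))
    (no t/M≮N) → trans (∉⇒occ≡0 (progression c M N) λ t∈ → case ∈-applyUpTo⁻ (λ i → c + i * M) t∈ of λ where
                          (i , i<N , t≡c+iM) → t/M≮N (subst (_< N) (progression-injective c (trans (sym t≡c+iM) (≡%⇒≡+/ t c≡t))) i<N))
                       (sym (iverson-no (t / M <? N) t/M≮N 1))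

coprime-*ʳ : ∀ {c x y} → Coprime c x → Coprime c y → Coprime c (x * y)
coprime-*ʳ c⊥x c⊥y (e∣c , e∣xy) = c⊥y (e∣c , coprime-divisor (λ (f∣e , f∣x) → c⊥x (∣-trans f∣e e∣c , f∣x)) e∣xy)

product-map-filter-≢ : ∀ {n} (d : Fin n → ℕ) i js → Unique js → i ∈ js →
  product (map d js) ≡ d i * product (map d (filter (λ j → ¬? (j Fin.≟ i)) js))
product-map-filter-≢ d i (j ∷ js) (j∉js ∷ js!) i∈ with j Fin.≟ i
... | yes refl = cong (d j *_) (cong (product ∘ map d) (sym (filter-all (λ k → ¬? (k Fin.≟ j)) (All.map (_∘ sym) j∉js))))
... | no j≢i with i∈
...   | here i≡j = contradiction (sym i≡j) j≢i
...   | there i∈js = trans (cong (d j *_) (product-map-filter-≢ d i js js! i∈js)) (swap (d j) (d i) _)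
  where swap : ∀ x y z → x * (y * z) ≡ y * (x * z)
        swap = ℕ-solve-∀

module Setting (n : ℕ) (d : Fin n → ℕ) (d>0 : ∀ i → 0 < d i) (d! : PairwiseCoprime d) where

  a : Fin n → ℕ
  a = aOf d

  p : ℕ
  p = pOf d

  σ : ℕ
  σ = σOf d

  modulus : List (Fin n) → ℕ
  modulus js = product (map d js)

  d≢0 : ∀ i → NonZero (d i)
  d≢0 i = >-nonZero (d>0 i)

  modulus≢0 : ∀ js → NonZero (modulus js)
  modulus≢0 js = product≢0 {ns = map d js} (All.map⁺ (All.tabulate (λ {i} _ → d≢0 i)))

  instance
    p≢0 : NonZero p
    p≢0 = modulus≢0 (allFin n)

  a≢0 : ∀ i → NonZero (a i)
  a≢0 i = modulus≢0 (filter (λ j → ¬? (j Fin.≟ i)) (allFin n))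

  d*a≡p : ∀ i → d i * a i ≡ p
  d*a≡p i = sym (product-map-filter-≢ d i (allFin n) (allFin⁺ n) (∈-allFin i))

  d∣a : ∀ i j → j ≢ i → d i ∣ a j
  d∣a i j j≢i = ∈⇒∣product (∈-map⁺ d (∈-filter⁺ (λ k → ¬? (k Fin.≟ j)) (∈-allFin i) (j≢i ∘ sym)))

  d⊥a : ∀ i → Coprime (d i) (a i)
  d⊥a i = coprime-product (filter (λ j → ¬? (j Fin.≟ i)) (allFin n)) (All.all-filter (λ j → ¬? (j Fin.≟ i)) (allFin n))
    where
    coprime-product : ∀ js → All (λ j → ¬ j ≡ i) js → Coprime (d i) (modulus js)
    coprime-product [] [] = Coprime.sym (1-coprimeTo (d i))
    coprime-product (j ∷ js) (j≢i ∷ js≢i) = coprime-*ʳ (d! i j (j≢i ∘ sym)) (coprime-product js js≢i)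

  -- the numbers ∑ᵢ rᵢ aᵢ with 0 ≤ rᵢ < dᵢ
  reps : List (Fin n) → List ℕ
  reps [] = 0 ∷ []
  reps (i ∷ js) = shifts (a i) (d i) (reps js)

  top : List (Fin n) → ℕ
  top js = sum (map (λ i → pred (d i) * a i) js)

  reps-∣ : ∀ c js → All (λ j → c ∣ a j) js → All (c ∣_) (reps js)
  reps-∣ c [] [] = (c ∣0) ∷ []
  reps-∣ c (i ∷ js) (c∣aᵢ ∷ c∣a) = All.tabulate λ z∈ → case ∈-shifts⁻ (a i) (d i) (reps js) z∈ of λ where
    (r , x , _ , x∈ , refl) → ∣m∣n⇒∣m+n (∣n⇒∣m*n r c∣aᵢ) (All.lookup (reps-∣ c js c∣a) x∈)

  reps-distinctMod : ∀ js → Unique js → DistinctMod (modulus js) {{modulus≢0 js}} (reps js)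
  reps-distinctMod [] [] = [] ∷ []
  reps-distinctMod (i ∷ js) (i∉js ∷ js!) =
    shifts-distinctMod {{d≢0 i}} {{modulus≢0 js}} {{modulus≢0 (i ∷ js)}} (d⊥a i) (reps-∣ (d i) js (All.map (λ {j} i≢j → d∣a i j (i≢j ∘ sym)) i∉js))
                       (reps-distinctMod js js!) (d i) ℕP.≤-refl

  length-reps : ∀ js → length (reps js) ≡ modulus js
  length-reps [] = refl
  length-reps (i ∷ js) = trans (length-shifts (a i) (d i) (reps js)) (cong (d i *_) (length-reps js))

  suc-pred-d : ∀ i → suc (pred (d i)) ≡ d i
  suc-pred-d i = ℕP.suc-pred (d i) {{d≢0 i}}

  pred[d]<d : ∀ i → pred (d i) < d i
  pred[d]<d i = subst (pred (d i) <_) (suc-pred-d i) ℕP.≤-refl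

  0∈reps : ∀ js → 0 ∈ reps js
  0∈reps [] = here refl
  0∈reps (i ∷ js) = ∈-shifts⁺ (a i) (d i) (reps js) (d>0 i) (0∈reps js)

  top∈reps : ∀ js → top js ∈ reps js
  top∈reps [] = here refl
  top∈reps (i ∷ js) = ∈-shifts⁺ (a i) (d i) (reps js) (pred[d]<d i) (top∈reps js)

  reps≤top : ∀ js → All (_≤ top js) (reps js)
  reps≤top [] = z≤n ∷ []
  reps≤top (i ∷ js) = All.tabulate λ z∈ → case ∈-shifts⁻ (a i) (d i) (reps js) z∈ of λ where
    (r , x , r<d , x∈ , refl) → ℕP.+-mono-≤ (ℕP.*-monoˡ-≤ (a i) (ℕP.≤-pred (ℕP.≤-trans r<d (ℕP.≤-reflexive (sym (suc-pred-d i))))))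
                                            (All.lookup (reps≤top js) x∈)

  sum-reps : ∀ js → 2 * sum (reps js) ≡ modulus js * top js
  sum-reps [] = refl
  sum-reps (i ∷ js) = begin
    2 * sum (shifts (a i) (d i) (reps js))                         ≡⟨ cong (λ D → 2 * sum (shifts (a i) D (reps js))) (suc-pred-d i) ⟨
    2 * sum (shifts (a i) (suc e) (reps js))                       ≡⟨ sum-shifts (a i) e (reps js) ⟩
    suc e * (2 * sum (reps js) + e * a i * length (reps js))       ≡⟨ cong₂ (λ S L → suc e * (S + e * a i * L)) (sum-reps js) (length-reps js) ⟩
    suc e * (modulus js * top js + e * a i * modulus js)           ≡⟨ regroup (suc e) (modulus js) (top js) (e * a i) ⟩
    (suc e * modulus js) * (e * a i + top js)                      ≡⟨ cong (λ D → (D * modulus js) * (e * a i + top js)) (suc-pred-d i) ⟩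
    modulus (i ∷ js) * top (i ∷ js)                                ∎
    where
    open ≡-Reasoning
    e = pred (d i)
    regroup : ∀ D M T x → D * (M * T + x * M) ≡ (D * M) * (x + T)
    regroup = ℕ-solve-∀

  top+∑a : ∀ js → top js + sum (map a js) ≡ length js * p
  top+∑a [] = refl
  top+∑a (i ∷ js) = begin
    pred (d i) * a i + top js + (a i + sum (map a js))      ≡⟨ regroup (pred (d i) * a i) (top js) (a i) (sum (map a js)) ⟩
    suc (pred (d i)) * a i + (top js + sum (map a js))      ≡⟨ cong₂ _+_ (trans (cong (_* a i) (suc-pred-d i)) (d*a≡p i)) (top+∑a js) ⟩
    p + length js * p                                      ∎
    where
    open ≡-Reasoning
    regroup : ∀ x y z w → x + y + (z + w) ≡ (z + x) + (y + w)
    regroup = ℕ-solve-∀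

  length-allFin : length (allFin n) ≡ n
  length-allFin = length-tabulate (λ i → i)

  ∏geom : List (Fin n) → PS
  ∏geom js = psProd (map (λ i → geom (a i) (d i)) js)

  ∏geom≈listSeries-reps : ∀ js → ∏geom js ≈ₚ listSeries (reps js)
  ∏geom≈listSeries-reps [] = ≈ₚ-sym listSeries-[0]
  ∏geom≈listSeries-reps (i ∷ js) =
    ≈ₚ-trans (⊛-congʳ (geom (a i) (d i)) (∏geom≈listSeries-reps js)) (geom-⊛-listSeries (a i) (d i) (reps js))

  ∏oneMinusXPow-⊛-∏geom : psProd (map oneMinusXPow (aList d)) ⊛ ∏geom (allFin n) ≈ₚ psPow (oneMinusXPow p) n
  ∏oneMinusXPow-⊛-∏geom = begin
    psProd (map oneMinusXPow (map a (allFin n))) ⊛ ∏geom (allFin n)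
      ≈⟨ ⊛-congˡ (∏geom (allFin n)) (λ t → cong (λ Fs → psProd Fs t) (sym (map-∘ (allFin n)))) ⟩
    psProd (map (oneMinusXPow ∘ a) (allFin n)) ⊛ ∏geom (allFin n)
      ≈⟨ psProd-map-⊛ (oneMinusXPow ∘ a) (λ i → geom (a i) (d i)) (allFin n) ⟩
    psProd (map (λ i → oneMinusXPow (a i) ⊛ geom (a i) (d i)) (allFin n))
      ≈⟨ psProd-map-const _ (oneMinusXPow p) (allFin n) oneMinusXPow-a⊛geom ⟩
    psPow (oneMinusXPow p) (length (allFin n))
      ≈⟨ (λ t → cong (λ k → psPow (oneMinusXPow p) k t) length-allFin) ⟩
    psPow (oneMinusXPow p) n ∎
    where
    open ≈ₚ-Reasoning
    oneMinusXPow-a⊛geom : ∀ i → oneMinusXPow (a i) ⊛ geom (a i) (d i) ≈ₚ oneMinusXPow p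
    oneMinusXPow-a⊛geom i = ≈ₚ-trans (⊛-comm (oneMinusXPow (a i)) (geom (a i) (d i)))
      (≈ₚ-trans (geom-⊛-oneMinusXPow (a i) (d i)) (λ t → cong (λ e → oneMinusXPow e t) (d*a≡p i)))

  open Multiples p

  solutionSeries≈reps⊛multiples^ : solutionSeries (aList d) ≈ₚ listSeries (reps (allFin n)) ⊛ multiples^ n
  solutionSeries≈reps⊛multiples^ = begin
    S                                                  ≈⟨ ⊛-identityʳ S ⟨
    S ⊛ psOne                                          ≈⟨ ⊛-congʳ S (oneMinusXPow^-⊛-multiples^ n) ⟨
    S ⊛ (psPow (oneMinusXPow p) n ⊛ multiples^ n)      ≈⟨ ⊛-congʳ S (⊛-congˡ (multiples^ n) ∏oneMinusXPow-⊛-∏geom) ⟨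
    S ⊛ ((Π ⊛ ∏geom (allFin n)) ⊛ multiples^ n)        ≈⟨ ⊛-congʳ S (⊛-assoc Π (∏geom (allFin n)) (multiples^ n)) ⟩
    S ⊛ (Π ⊛ (∏geom (allFin n) ⊛ multiples^ n))        ≈⟨ ⊛-assoc S Π _ ⟨
    (S ⊛ Π) ⊛ (∏geom (allFin n) ⊛ multiples^ n)        ≈⟨ ⊛-congˡ _ (⊛-comm S Π) ⟩
    (Π ⊛ S) ⊛ (∏geom (allFin n) ⊛ multiples^ n)        ≈⟨ ⊛-congˡ _ (∏oneMinusXPow-⊛-solutionSeries (aList d) a>0) ⟩
    psOne ⊛ (∏geom (allFin n) ⊛ multiples^ n)          ≈⟨ ⊛-identityˡ _ ⟩
    ∏geom (allFin n) ⊛ multiples^ n                    ≈⟨ ⊛-congˡ (multiples^ n) (∏geom≈listSeries-reps (allFin n)) ⟩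
    listSeries (reps (allFin n)) ⊛ multiples^ n        ∎
    where
    open ≈ₚ-Reasoning
    S = solutionSeries (aList d)
    Π = psProd (map oneMinusXPow (aList d))
    a>0 : All (0 <_) (aList d)
    a>0 = All.map⁺ (All.tabulate (λ {i} _ → >-nonZero⁻¹ (a i) {{a≢0 i}}))

module ResidueSystem (p : ℕ) .{{_ : NonZero p}} {R : List ℕ} (R! : DistinctMod p R) where

  open Multiples p

  private
    term-vanishes : ∀ k t i → i ≤ t → (i ∈ R → i % p ≢ t % p) → listSeries R i ℤ.* multiples^ k (t ∸ i) ≡ 0ℤ
    term-vanishes k t i i≤t apart with occ i R in occ≡
    ... | zero = refl
    ... | suc c = trans (cong (ℤ.+ suc c ℤ.*_) (multiples^-non-multiple k (t ∸ i) t∸i≢0)) (ℤP.*-zeroʳ (ℤ.+ suc c))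
      where
      i∈R : i ∈ R
      i∈R = occ>0⇒∈ R (subst (0 <_) (sym occ≡) (s≤s z≤n))
      t∸i≢0 : (t ∸ i) % p ≢ 0
      t∸i≢0 t∸i≡0 = apart i∈R (trans (sym (%-remove-+ʳ i (m%n≡0⇒n∣m (t ∸ i) p t∸i≡0))) (cong (_% p) (ℕP.m+[n∸m]≡n i≤t)))

  coeff-at : ∀ m {r} j → r ∈ R → (listSeries R ⊛ multiples^ (suc m)) (r + j * p) ≡ ℤ.+ binomial j m
  coeff-at m {r} j r∈R = begin
    (listSeries R ⊛ multiples^ (suc m)) t                                   ≡⟨ ⊛-coeff (listSeries R) (multiples^ (suc m)) t ⟩
    ℤΣ.∑< (suc t) (λ i → listSeries R i ℤ.* multiples^ (suc m) (t ∸ i))     ≡⟨ ℤΣ.∑<-single (suc t) r (s≤s (ℕP.m≤m+n r _)) others ⟩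
    listSeries R r ℤ.* multiples^ (suc m) (t ∸ r)                           ≡⟨ cong₂ ℤ._*_ (cong ℤ.+_ (∈-unique⇒occ≡1 R (distinctMod⇒unique R!) r∈R)) (cong (multiples^ (suc m)) (ℕP.m+n∸m≡n r (j * p))) ⟩
    1ℤ ℤ.* multiples^ (suc m) (j * p)                                       ≡⟨ ℤP.*-identityˡ _ ⟩
    multiples^ (suc m) (j * p)                                              ≡⟨ multiples^-multiple m j ⟩
    ℤ.+ binomial j m                                                        ∎
    where
    open ≡-Reasoning
    t = r + j * p
    others : ∀ i → i < suc t → i ≢ r → listSeries R i ℤ.* multiples^ (suc m) (t ∸ i) ≡ 0ℤ
    others i i≤t i≢r = term-vanishes (suc m) t i (ℕP.≤-pred i≤t)
      (λ i∈R i≡t → i≢r (distinctMod-≡ R! i∈R r∈R (trans i≡t ([m+kn]%n≡m%n r j p))))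

  coeff-gap : ∀ m {r} t → r ∈ R → r % p ≡ t % p → t < r → (listSeries R ⊛ multiples^ (suc m)) t ≡ 0ℤ
  coeff-gap m {r} t r∈R r≡t t<r = trans (⊛-coeff (listSeries R) (multiples^ (suc m)) t)
    (ℤΣ.∑<-zero (suc t) (λ i i≤t → term-vanishes (suc m) t i (ℕP.≤-pred i≤t)
      (λ i∈R i≡t → ℕP.<⇒≱ t<r (subst (_≤ t) (distinctMod-≡ R! i∈R r∈R (trans i≡t (sym r≡t))) (ℕP.≤-pred i≤t)))))

module LevelSets (m : ℕ) (d : Fin (suc (suc m)) → ℕ) (d>0 : ∀ i → 0 < d i) (d! : PairwiseCoprime d) where

  n : ℕ
  n = suc (suc m)

  open Setting n d d>0 d!
  open Multiples p

  R : List ℕ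
  R = reps (allFin n)

  R! : DistinctMod p R
  R! = reps-distinctMod (allFin n) (allFin⁺ n)

  |R|≡p : length R ≡ p
  |R|≡p = length-reps (allFin n)

  Rmax : ℕ
  Rmax = top (allFin n)

  R≤Rmax : ∀ {r} → r ∈ R → r ≤ Rmax
  R≤Rmax = All.lookup (reps≤top (allFin n))

  Rmax+σ≡n*p : Rmax + σ ≡ n * p
  Rmax+σ≡n*p = trans (top+∑a (allFin n)) (cong (_* p) length-allFin)

  open ResidueSystem p R!

  f : ℕ → ℕ
  f = solutions (aList d)

  height : ℕ → ℕ
  height s = (s + n ∸ 1) C (n ∸ 1)

  height≡binomial : ∀ s → height s ≡ binomial s (suc m)
  height≡binomial s = cong (λ x → (x ∸ 1) C suc m) (ℕP.+-suc s (suc m))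

  height-cancel-≤ : ∀ {j j′} → height j ≤ height j′ → j ≤ j′
  height-cancel-≤ {j} {j′} le = binomial-cancel-≤ m (subst₂ _≤_ (height≡binomial j) (height≡binomial j′) le)

  height-mono-≤ : ∀ {j j′} → j ≤ j′ → height j ≤ height j′
  height-mono-≤ {j} {j′} le = subst₂ _≤_ (sym (height≡binomial j)) (sym (height≡binomial j′)) (binomial-mono-≤ m le)

  height-injective : ∀ {j j′} → height j ≡ height j′ → j ≡ j′
  height-injective {j} {j′} eq = ℕP.≤-antisym (height-cancel-≤ {j} {j′} (ℕP.≤-reflexive eq)) (height-cancel-≤ {j′} {j} (ℕP.≤-reflexive (sym eq)))

  height≰0 : ∀ s → ¬ height s ≤ 0
  height≰0 s = ℕP.<⇒≱ (subst (0 <_) (sym (height≡binomial s)) (binomial-pos s (suc m)))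

  f-at : ∀ {r} j → r ∈ R → f (r + j * p) ≡ height j
  f-at j r∈R = ℤP.+-injective (trans (solutionSeries≈reps⊛multiples^ (_ + j * p)) (trans (coeff-at (suc m) j r∈R) (cong ℤ.+_ (sym (height≡binomial j)))))

  f-gap : ∀ {r} t → r ∈ R → r % p ≡ t % p → t < r → f t ≡ 0
  f-gap t r∈R r≡t t<r = ℤP.+-injective (trans (solutionSeries≈reps⊛multiples^ t) (coeff-gap (suc m) t r∈R r≡t t<r))

  data Position (t : ℕ) : Set where
    at : ∀ {r} j → r ∈ R → t ≡ r + j * p → Position t
    gap : ∀ {r} → r ∈ R → r % p ≡ t % p → t < r → Position t

  position : ∀ t → Position t
  position t with distinctMod-complete R! |R|≡p t
  ... | r , r∈R , r≡t with ℕP.<-≤-connex t r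
  ...   | inj₁ t<r = gap r∈R r≡t t<r
  ...   | inj₂ r≤t with %-≡⇒offset-multiple r≡t r≤t
  ...     | j , t≡r+jp = at j r∈R t≡r+jp

  f-values : ∀ k t → f t ≡ k → k ≡ 0 ⊎ ∃ λ s → k ≡ height s
  f-values _ t refl with position t
  ... | at j r∈R refl = inj₂ (j , f-at j r∈R)
  ... | gap r∈R r≡t t<r = inj₁ (f-gap t r∈R r≡t t<r)

  f-top : ∀ s → f (Rmax + s * p) ≡ height s
  f-top s = f-at s (top∈reps (allFin n))

  f-bottom : ∀ s → f (s * p) ≡ height s
  f-bottom s = f-at s (0∈reps (allFin n))

  f≤height⇒≤ : ∀ s {t} → f t ≤ height s → t ≤ Rmax + s * p
  f≤height⇒≤ s {t} ft≤ with position t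
  ... | at j r∈R refl = ℕP.+-mono-≤ (R≤Rmax r∈R) (ℕP.*-monoˡ-≤ p (height-cancel-≤ {j} {s} (subst (_≤ height s) (f-at j r∈R) ft≤)))
  ... | gap r∈R _ t<r = ℕP.≤-trans (ℕP.<⇒≤ t<r) (ℕP.≤-trans (R≤Rmax r∈R) (ℕP.m≤m+n Rmax (s * p)))

  height≤f⇒≥ : ∀ s {t} → height s ≤ f t → s * p ≤ t
  height≤f⇒≥ s {t} ≤ft with position t
  ... | at {r} j r∈R refl = ℕP.≤-trans (ℕP.*-monoˡ-≤ p (height-cancel-≤ {s} {j} (subst (height s ≤_) (f-at j r∈R) ≤ft))) (ℕP.m≤n+m (j * p) r)
  ... | gap r∈R r≡t t<r = contradiction (subst (height s ≤_) (f-gap t r∈R r≡t t<r) ≤ft) (height≰0 s)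

  f≡height⇒∈ : ∀ s t′ → f (s * p + t′) ≡ height s → t′ ∈ R
  f≡height⇒∈ s t′ f≡ with position (s * p + t′)
  ... | at {r} j r∈R t≡r+jp = subst (_∈ R) (sym t′≡r) r∈R
    where
    j≡s : j ≡ s
    j≡s = height-injective (trans (sym (f-at j r∈R)) (trans (cong f (sym t≡r+jp)) f≡))
    t′≡r : t′ ≡ r
    t′≡r = ℕP.+-cancelˡ-≡ (s * p) t′ r (trans t≡r+jp (trans (cong (λ k → r + k * p) j≡s) (ℕP.+-comm r (s * p))))
  ... | gap r∈R r≡t t<r = contradiction (ℕP.≤-reflexive (trans (sym f≡) (f-gap (s * p + t′) r∈R r≡t t<r))) (height≰0 s)

  level-set : ℕ → List ℕ
  level-set s = map (s * p +_) R

  [f≡height]≡occ : ∀ s t → iverson (f t ≟ height s) 1 ≡ occ t (level-set s)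
  [f≡height]≡occ s t with split (s * p) t
  ... | below t<sp = trans (iverson-no (f t ≟ height s) (λ f≡ → ℕP.<⇒≱ t<sp (height≤f⇒≥ s (ℕP.≤-reflexive (sym f≡)))) 1)
                           (sym (occ-map-+-below (s * p) t R t<sp))
  ... | offset t′ refl with t′ ∈? R
  ...   | yes t′∈R = trans (iverson-yes (f (s * p + t′) ≟ height s) (trans (cong f (ℕP.+-comm (s * p) t′)) (f-at s t′∈R)) 1)
                           (sym (trans (occ-map-+-offset (s * p) t′ R) (∈-unique⇒occ≡1 R (distinctMod⇒unique R!) t′∈R)))
  ...   | no t′∉R = trans (iverson-no (f (s * p + t′) ≟ height s) (t′∉R ∘ f≡height⇒∈ s t′) 1)
                           (sym (trans (occ-map-+-offset (s * p) t′ R) (∉⇒occ≡0 R t′∉R)))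

  level-set<bound : ∀ s → All (_< suc (Rmax + s * p)) (level-set s)
  level-set<bound s = All.map⁺ (All.tabulate (λ {r} r∈R → s≤s (subst (_≤ Rmax + s * p) (ℕP.+-comm r (s * p)) (ℕP.+-monoˡ-≤ (s * p) (R≤Rmax r∈R)))))

  count-f≡height : ∀ s → HasCount (λ t → f t ≟ height s) p
  count-f≡height s = suc (Rmax + s * p)
                   , (λ t t>Rmax+sp f≡ → ℕP.<⇒≱ t>Rmax+sp (f≤height⇒≤ s (ℕP.≤-reflexive f≡)))
                   , trans (countBelow-occ (λ t → f t ≟ height s) (suc (Rmax + s * p)) (level-set s) (level-set<bound s) (λ t _ → [f≡height]≡occ s t))
                           (trans (length-map (s * p +_) R) |R|≡p)

  sum-f≡height : ∀ s → Σ ℕ (λ S → HasSum (λ t → f t ≟ height s) S × 2 * S + p * σ ≡ p * ((2 * s + n) * p))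
  sum-f≡height s = sum (level-set s)
                 , (suc (Rmax + s * p)
                   , (λ t t>Rmax+sp f≡ → ℕP.<⇒≱ t>Rmax+sp (f≤height⇒≤ s (ℕP.≤-reflexive f≡)))
                   , sumBelow-occ (λ t → f t ≟ height s) (suc (Rmax + s * p)) (level-set s) (level-set<bound s) (λ t _ → [f≡height]≡occ s t))
                 , (begin
    2 * sum (level-set s) + p * σ          ≡⟨ cong (λ S → 2 * S + p * σ) (trans (sum-map-+ˡ (s * p) R) (cong (λ l → l * (s * p) + sum R) |R|≡p)) ⟩
    2 * (p * (s * p) + sum R) + p * σ      ≡⟨ distrib p (s * p) (sum R) σ ⟩
    2 * (p * (s * p)) + 2 * sum R + p * σ  ≡⟨ cong (λ x → 2 * (p * (s * p)) + x + p * σ) (sum-reps (allFin n)) ⟩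
    2 * (p * (s * p)) + p * Rmax + p * σ   ≡⟨ factor p (s * p) Rmax σ ⟩
    2 * (p * (s * p)) + p * (Rmax + σ)     ≡⟨ cong (λ x → 2 * (p * (s * p)) + p * x) Rmax+σ≡n*p ⟩
    2 * (p * (s * p)) + p * (n * p)        ≡⟨ collect p s n ⟩
    p * ((2 * s + n) * p)                  ∎)
    where
    open ≡-Reasoning
    distrib : ∀ p x S σ → 2 * (p * x + S) + p * σ ≡ 2 * (p * x) + 2 * S + p * σ
    distrib = ℕ-solve-∀
    factor : ∀ p x T σ → 2 * (p * x) + p * T + p * σ ≡ 2 * (p * x) + p * (T + σ)
    factor = ℕ-solve-∀
    collect : ∀ p s n → 2 * (p * (s * p)) + p * (n * p) ≡ p * ((2 * s + n) * p)
    collect = ℕ-solve-∀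

  -- the t ≡ r (mod p) with t ≤ r + s p, which in the residue class of r are exactly the t with f t ≤ height s
  window : ℕ → ℕ → List ℕ
  window s r = progression (r % p) p (r / p + suc s)

  windows : ℕ → List ℕ
  windows s = concatMap (window s) R

  occ-windows : ∀ s t {r} → r ∈ R → r % p ≡ t % p → occ t (windows s) ≡ iverson (t / p <? r / p + suc s) 1
  occ-windows s t {r} r∈R r≡t = begin
    occ t (windows s)                   ≡⟨ occ-concatMap t (window s) R ⟩
    sum (map (occ t ∘ window s) R)      ≡⟨ sum-map-single (occ t ∘ window s) (distinctMod⇒unique R!) r∈R others ⟩
    occ t (window s r)                  ≡⟨ occ-progression-≡ (r / p + suc s) t r≡t ⟩
    iverson (t / p <? r / p + suc s) 1  ∎
    where
    open ≡-Reasoning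
    others : ∀ {x} → x ∈ R → x ≢ r → occ t (window s x) ≡ 0
    others {x} x∈R x≢r = occ-progression-≢ (x / p + suc s) t (m%n<n x p)
      (λ x≡t → x≢r (distinctMod-≡ R! x∈R r∈R (trans x≡t (sym r≡t))))

  [r+jp]/p≡r/p+j : ∀ r j → (r + j * p) / p ≡ r / p + j
  [r+jp]/p≡r/p+j r j = trans (+-distrib-/-∣ʳ r (n∣m*n j)) (cong (r / p +_) (m*n/n≡m j p))

  [f≤height]≡occ : ∀ s t → iverson (f t ≤? height s) 1 ≡ occ t (windows s)
  [f≤height]≡occ s t with position t
  ... | at {r} j r∈R refl = trans (iverson-cong (f t ≤? height s) (t / p <? r / p + suc s) to from 1)
                                   (sym (occ-windows s t r∈R (sym ([m+kn]%n≡m%n r j p))))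
    where
    to : f t ≤ height s → t / p < r / p + suc s
    to f≤ = subst (_< r / p + suc s) (sym ([r+jp]/p≡r/p+j r j))
              (ℕP.+-monoʳ-< (r / p) (s≤s (height-cancel-≤ {j} {s} (subst (_≤ height s) (f-at j r∈R) f≤))))
    from : t / p < r / p + suc s → f t ≤ height s
    from t/p< = subst (_≤ height s) (sym (f-at j r∈R))
      (height-mono-≤ (ℕP.≤-pred (ℕP.+-cancelˡ-< (r / p) j (suc s) (subst (_< r / p + suc s) ([r+jp]/p≡r/p+j r j) t/p<))))
  ... | gap {r} r∈R r≡t t<r = trans (iverson-cong (f t ≤? height s) (t / p <? r / p + suc s)
                                        (λ _ → ℕP.≤-<-trans (/-monoˡ-≤ p (ℕP.<⇒≤ t<r)) (ℕP.m<m+n (r / p) (s≤s z≤n)))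
                                        (λ _ → subst (_≤ height s) (sym (f-gap t r∈R r≡t t<r)) z≤n) 1)
                                   (sym (occ-windows s t r∈R r≡t))

  windows<bound : ∀ s → All (_< suc (Rmax + s * p)) (windows s)
  windows<bound s = All.concat⁺ (All.map⁺ (All.tabulate (λ {r} r∈R →
    All.applyUpTo⁺₁ (λ i → r % p + i * p) (r / p + suc s) (λ {i} i< → s≤s (begin
      r % p + i * p                ≤⟨ ℕP.+-monoʳ-≤ (r % p) (ℕP.*-monoˡ-≤ p (ℕP.≤-pred (subst (i <_) (ℕP.+-suc (r / p) s) i<))) ⟩
      r % p + (r / p + s) * p      ≡⟨ regroup (r % p) (r / p) s p ⟩
      (r % p + r / p * p) + s * p  ≡⟨ cong (_+ s * p) (m≡m%n+[m/n]*n r p) ⟨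
      r + s * p                    ≤⟨ ℕP.+-monoˡ-≤ (s * p) (R≤Rmax r∈R) ⟩
      Rmax + s * p                 ∎)))))
    where
    open ℕP.≤-Reasoning
    regroup : ∀ x q s p → x + (q + s) * p ≡ (x + q * p) + s * p
    regroup = ℕ-solve-∀

  2*∑quotients+σ : 2 * sum (map (_/ p) R) + σ ≡ suc m * p + 1
  2*∑quotients+σ = ℕP.+-cancelʳ-≡ p (2 * X + σ) (suc m * p + 1) (ℕP.*-cancelˡ-≡ (2 * X + σ + p) (suc m * p + 1 + p) p (begin
    p * (2 * X + σ + p)                ≡⟨ expand p X σ ⟩
    2 * (X * p) + p * σ + p * p        ≡⟨ cong (2 * (X * p) + p * σ +_) (2*∑<-id+n≡n*n p) ⟨
    2 * (X * p) + p * σ + (2 * Y + p)  ≡⟨ regroup X p σ Y ⟩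
    2 * (Y + X * p) + p + p * σ        ≡⟨ cong (λ S → 2 * S + p + p * σ) ∑R≡Y+Xp ⟨
    2 * sum R + p + p * σ              ≡⟨ cong (λ S → S + p + p * σ) (sum-reps (allFin n)) ⟩
    p * Rmax + p + p * σ               ≡⟨ factor p Rmax σ ⟩
    p * (Rmax + σ) + p                 ≡⟨ cong (λ x → p * x + p) Rmax+σ≡n*p ⟩
    p * (n * p) + p                    ≡⟨ collect p m ⟩
    p * (suc m * p + 1 + p)            ∎))
    where
    open ≡-Reasoning
    X = sum (map (_/ p) R)
    residues = map (_% p) R
    Y = ℕΣ.∑< p (λ u → u)
    Y≡∑residues : Y ≡ sum residues
    Y≡∑residues = begin
      ℕΣ.∑< p (λ u → u)                   ≡⟨ ℕΣ.∑<-cong p (λ u u<p → trans (sym (ℕP.*-identityˡ u)) (cong (_* u) (sym (distinctMod-occ-residue R! |R|≡p u u<p)))) ⟩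
      ℕΣ.∑< p (λ u → occ u residues * u)  ≡⟨ ∑<-occ p (λ u → u) residues (All.map⁺ (All.tabulate (λ {x} _ → m%n<n x p))) ⟩
      sum (map (λ u → u) residues)        ≡⟨ cong sum (map-id residues) ⟩
      sum residues                        ∎
    ∑R≡Y+Xp : sum R ≡ Y + X * p
    ∑R≡Y+Xp = begin
      sum R                                  ≡⟨ cong sum (map-id R) ⟨
      sum (map (λ r → r) R)                  ≡⟨ cong sum (map-cong (λ r → m≡m%n+[m/n]*n r p) R) ⟩
      sum (map (λ r → r % p + r / p * p) R)  ≡⟨ sum-map-+-distrib (_% p) (λ r → r / p * p) R ⟩
      sum residues + sum (map (λ r → r / p * p) R) ≡⟨ cong₂ _+_ (sym Y≡∑residues) (sum-map-*ʳ (_/ p) p R) ⟩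
      Y + X * p                                    ∎
    expand : ∀ p X σ → p * (2 * X + σ + p) ≡ 2 * (X * p) + p * σ + p * p
    expand = ℕ-solve-∀
    regroup : ∀ X p σ Y → 2 * (X * p) + p * σ + (2 * Y + p) ≡ 2 * (Y + X * p) + p + p * σ
    regroup = ℕ-solve-∀
    factor : ∀ p T σ → p * T + p + p * σ ≡ p * (T + σ) + p
    factor = ℕ-solve-∀
    collect : ∀ p m → p * (suc (suc m) * p) + p ≡ p * (suc m * p + 1 + p)
    collect = ℕ-solve-∀

  count-f≤height : ∀ s → Σ ℕ (λ c → HasCount (λ t → f t ≤? height s) c × 2 * c + σ ≡ 2 * ((s + 1) * p) + (suc m * p + 1))
  count-f≤height s = length (windows s)
                   , (suc (Rmax + s * p)
                     , (λ t t>Rmax+sp f≤ → ℕP.<⇒≱ t>Rmax+sp (f≤height⇒≤ s f≤))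
                     , countBelow-occ (λ t → f t ≤? height s) (suc (Rmax + s * p)) (windows s) (windows<bound s) (λ t _ → [f≤height]≡occ s t))
                   , (begin
    2 * length (windows s) + σ                        ≡⟨ cong (λ l → 2 * l + σ) length-windows ⟩
    2 * (sum (map (_/ p) R) + p * suc s) + σ          ≡⟨ regroup (sum (map (_/ p) R)) p s σ ⟩
    (2 * sum (map (_/ p) R) + σ) + 2 * ((s + 1) * p)  ≡⟨ cong (_+ 2 * ((s + 1) * p)) 2*∑quotients+σ ⟩
    suc m * p + 1 + 2 * ((s + 1) * p)                 ≡⟨ ℕP.+-comm (suc m * p + 1) (2 * ((s + 1) * p)) ⟩
    2 * ((s + 1) * p) + (suc m * p + 1)               ∎)
    where
    open ≡-Reasoning
    length-windows : length (windows s) ≡ sum (map (_/ p) R) + p * suc s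
    length-windows = begin
      length (windows s)                              ≡⟨ length-concatMap (window s) R ⟩
      sum (map (length ∘ window s) R)                 ≡⟨ cong sum (map-cong (λ r → length-applyUpTo (λ i → r % p + i * p) (r / p + suc s)) R) ⟩
      sum (map (λ r → r / p + suc s) R)               ≡⟨ sum-map-+-distrib (_/ p) (λ _ → suc s) R ⟩
      sum (map (_/ p) R) + sum (map (λ _ → suc s) R)  ≡⟨ cong (sum (map (_/ p) R) +_) (trans (sum-map-const (suc s) R) (cong (_* suc s) |R|≡p)) ⟩
      sum (map (_/ p) R) + p * suc s                  ∎
    regroup : ∀ X p s σ → 2 * (X + p * suc s) + σ ≡ (2 * X + σ) + 2 * ((s + 1) * p)
    regroup = ℕ-solve-∀

  Π : PS
  Π = psProd (map oneMinusXPow (aList d))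

  listSeries-R-⊛-Π : listSeries R ⊛ Π ≈ₚ psPow (oneMinusXPow p) n
  listSeries-R-⊛-Π = begin
    listSeries R ⊛ Π          ≈⟨ ⊛-congˡ Π (∏geom≈listSeries-reps (allFin n)) ⟨
    ∏geom (allFin n) ⊛ Π      ≈⟨ ⊛-comm (∏geom (allFin n)) Π ⟩
    Π ⊛ ∏geom (allFin n)      ≈⟨ ∏oneMinusXPow-⊛-∏geom ⟩
    psPow (oneMinusXPow p) n  ∎
    where open ≈ₚ-Reasoning

  indicator-f≡height : ∀ s → indicatorSeries (λ t → f t ≟ height s) ≈ₚ xPow (s * p) ⊛ listSeries R
  indicator-f≡height s t = trans (indicatorSeries-iverson (λ t → f t ≟ height s) t)
                                 (trans (cong ℤ.+_ ([f≡height]≡occ s t)) (listSeries-map-+ (s * p) R t))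

  series-f≡height : ∀ s → indicatorSeries (λ t → f t ≟ height s) ⊛ Π ≈ₚ xPow (s * p) ⊛ psPow (oneMinusXPow p) n
  series-f≡height s = begin
    indicatorSeries (λ t → f t ≟ height s) ⊛ Π  ≈⟨ ⊛-congˡ Π (indicator-f≡height s) ⟩
    (xPow (s * p) ⊛ listSeries R) ⊛ Π           ≈⟨ ⊛-assoc (xPow (s * p)) (listSeries R) Π ⟩
    xPow (s * p) ⊛ (listSeries R ⊛ Π)           ≈⟨ ⊛-congʳ (xPow (s * p)) listSeries-R-⊛-Π ⟩
    xPow (s * p) ⊛ psPow (oneMinusXPow p) n     ∎
    where open ≈ₚ-Reasoning

  height≤f⇒rep≤ : ∀ s t {r} → r ∈ R → r % p ≡ t % p → height s ≤ f (s * p + t) → r ≤ t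
  height≤f⇒rep≤ s t {r} r∈R r≡t ≤f with position (s * p + t)
  ... | at {r′} j r′∈R sp+t≡r′+jp = ℕP.+-cancelˡ-≤ (s * p) r t (begin
    s * p + r   ≡⟨ ℕP.+-comm (s * p) r ⟩
    r + s * p   ≤⟨ ℕP.+-monoʳ-≤ r (ℕP.*-monoˡ-≤ p (height-cancel-≤ {s} {j} (subst (height s ≤_) (f-at j r′∈R) (subst (λ u → height s ≤ f u) sp+t≡r′+jp ≤f)))) ⟩
    r + j * p   ≡⟨ cong (_+ j * p) r≡r′ ⟩
    r′ + j * p  ≡⟨ sp+t≡r′+jp ⟨
    s * p + t   ∎)
    where
    open ℕP.≤-Reasoning
    r≡r′ : r ≡ r′
    r≡r′ = distinctMod-≡ R! r∈R r′∈R (trans r≡t (sym (trans (sym ([m+kn]%n≡m%n r′ j p))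
             (trans (cong (_% p) (sym sp+t≡r′+jp)) (trans (cong (_% p) (ℕP.+-comm (s * p) t)) ([m+kn]%n≡m%n t s p))))))
  ... | gap r′∈R r′≡ sp+t<r′ = contradiction (subst (height s ≤_) (f-gap (s * p + t) r′∈R r′≡ sp+t<r′) ≤f) (height≰0 s)

  [height≤f]≡coeff : ∀ s t → ℤ.+ iverson (f (s * p + t) ≥? height s) 1 ≡ (listSeries R ⊛ multiples^ 1) t
  [height≤f]≡coeff s t with position t
  ... | at {r} j r∈R refl = trans (cong ℤ.+_ (iverson-yes (f (s * p + t) ≥? height s) height≤ 1)) (sym (coeff-at 0 j r∈R))
    where
    height≤ : height s ≤ f (s * p + (r + j * p))
    height≤ = subst (height s ≤_) (sym (trans (cong f (regroup s p r j)) (f-at (j + s) r∈R))) (height-mono-≤ (ℕP.m≤n+m s j))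
      where regroup : ∀ s p r j → s * p + (r + j * p) ≡ r + (j + s) * p
            regroup = ℕ-solve-∀
  ... | gap r∈R r≡t t<r = trans (cong ℤ.+_ (iverson-no (f (s * p + t) ≥? height s) (ℕP.<⇒≱ t<r ∘ height≤f⇒rep≤ s t r∈R r≡t) 1))
                                (sym (coeff-gap 0 t r∈R r≡t t<r))

  indicator-f≥height : ∀ s → indicatorSeries (λ t → f t ≥? height s) ≈ₚ xPow (s * p) ⊛ (listSeries R ⊛ multiples^ 1)
  indicator-f≥height s = ≈ₚ-xPow-⊛ (s * p) (indicatorSeries (λ t → f t ≥? height s)) (listSeries R ⊛ multiples^ 1)
    (λ t t<sp → trans (indicatorSeries-iverson (λ t → f t ≥? height s) t)
                      (cong ℤ.+_ (iverson-no (f t ≥? height s) (ℕP.<⇒≱ t<sp ∘ height≤f⇒≥ s) 1)))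
    (λ t → trans (indicatorSeries-iverson (λ t → f t ≥? height s) (s * p + t)) ([height≤f]≡coeff s t))

  series-f≥height : ∀ s → indicatorSeries (λ t → f t ≥? height s) ⊛ Π ≈ₚ xPow (s * p) ⊛ psPow (oneMinusXPow p) (suc m)
  series-f≥height s = begin
    indicatorSeries (λ t → f t ≥? height s) ⊛ Π           ≈⟨ ⊛-congˡ Π (indicator-f≥height s) ⟩
    (xPow (s * p) ⊛ (listSeries R ⊛ multiples^ 1)) ⊛ Π    ≈⟨ ⊛-assoc (xPow (s * p)) (listSeries R ⊛ multiples^ 1) Π ⟩
    xPow (s * p) ⊛ ((listSeries R ⊛ multiples^ 1) ⊛ Π)    ≈⟨ ⊛-congʳ (xPow (s * p)) reorder ⟩
    xPow (s * p) ⊛ ((listSeries R ⊛ Π) ⊛ multiples^ 1)    ≈⟨ ⊛-congʳ (xPow (s * p)) (⊛-congˡ (multiples^ 1) listSeries-R-⊛-Π) ⟩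
    xPow (s * p) ⊛ ((oneMinusXPow p ⊛ A) ⊛ multiples^ 1)  ≈⟨ ⊛-congʳ (xPow (s * p)) (⊛-congˡ (multiples^ 1) (⊛-comm (oneMinusXPow p) A)) ⟩
    xPow (s * p) ⊛ ((A ⊛ oneMinusXPow p) ⊛ multiples^ 1)  ≈⟨ ⊛-congʳ (xPow (s * p)) (⊛-assoc A (oneMinusXPow p) (multiples^ 1)) ⟩
    xPow (s * p) ⊛ (A ⊛ (oneMinusXPow p ⊛ multiples^ 1))  ≈⟨ ⊛-congʳ (xPow (s * p)) (⊛-congʳ A (oneMinusXPow-⊛-multiples^ 0)) ⟩
    xPow (s * p) ⊛ (A ⊛ psOne)                            ≈⟨ ⊛-congʳ (xPow (s * p)) (⊛-identityʳ A) ⟩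
    xPow (s * p) ⊛ A                                      ∎
    where
    open ≈ₚ-Reasoning
    A = psPow (oneMinusXPow p) (suc m)
    reorder : (listSeries R ⊛ multiples^ 1) ⊛ Π ≈ₚ (listSeries R ⊛ Π) ⊛ multiples^ 1
    reorder = ≈ₚ-trans (⊛-assoc (listSeries R) (multiples^ 1) Π)
              (≈ₚ-trans (⊛-congʳ (listSeries R) (⊛-comm (multiples^ 1) Π)) (≈ₚ-sym (⊛-assoc (listSeries R) Π (multiples^ 1))))

  [s+n]p∸σ≡Rmax+sp : ∀ s → (s + n) * p ∸ σ ≡ Rmax + s * p
  [s+n]p∸σ≡Rmax+sp s = begin
    (s + n) * p ∸ σ         ≡⟨ cong (_∸ σ) (ℕP.*-distribʳ-+ p s n) ⟩
    s * p + n * p ∸ σ       ≡⟨ cong (λ x → s * p + x ∸ σ) Rmax+σ≡n*p ⟨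
    s * p + (Rmax + σ) ∸ σ  ≡⟨ cong (_∸ σ) (ℕP.+-assoc (s * p) Rmax σ) ⟨
    s * p + Rmax + σ ∸ σ    ≡⟨ ℕP.m+n∸n≡m (s * p + Rmax) σ ⟩
    s * p + Rmax            ≡⟨ ℕP.+-comm (s * p) Rmax ⟩
    Rmax + s * p            ∎
    where open ≡-Reasoning

  max-f≤height : ∀ s → IsMax (λ t → f t ≤ height s) ((s + n) * p ∸ σ)
  max-f≤height s rewrite [s+n]p∸σ≡Rmax+sp s =
    ℕP.≤-reflexive (f-top s) , λ t t>Rmax+sp f≤ → ℕP.<⇒≱ t>Rmax+sp (f≤height⇒≤ s f≤)

  max-f≡height : ∀ s → IsMax (λ t → f t ≡ height s) ((s + n) * p ∸ σ)
  max-f≡height s rewrite [s+n]p∸σ≡Rmax+sp s =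
    f-top s , λ t t>Rmax+sp f≡ → ℕP.<⇒≱ t>Rmax+sp (f≤height⇒≤ s (ℕP.≤-reflexive f≡))

  min-f≥height : ∀ s → IsMin (λ t → f t ≥ height s) (s * p)
  min-f≥height s = ℕP.≤-reflexive (sym (f-bottom s)) , λ t t<sp ≤f → ℕP.<⇒≱ t<sp (height≤f⇒≥ s ≤f)

  min-f≡height : ∀ s → IsMin (λ t → f t ≡ height s) (s * p)
  min-f≡height s = f-bottom s , λ t t<sp f≡ → ℕP.<⇒≱ t<sp (height≤f⇒≥ s (ℕP.≤-reflexive (sym f≡)))

proposition1p16 : (n : ℕ) → 2 ≤ n → (d : Fin n → ℕ) → (∀ i → 0 < d i) → PairwiseCoprime d →
    let a = aOf d
        p = pOf d
        σ = σOf d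
        f = solutions (aList d)
    in (∀ k t → f t ≡ k → k ≡ 0 ⊎ Σ ℕ (λ s → k ≡ (s + n ∸ 1) C (n ∸ 1)))
       × (∀ s → let k = (s + n ∸ 1) C (n ∸ 1) in
            IsMax (λ t → f t ≡ k) ((s + n) * p ∸ σ)
          × IsMax (λ t → f t ≤ k) ((s + n) * p ∸ σ)
          × IsMin (λ t → f t ≡ k) (s * p)
          × IsMin (λ t → f t ≥ k) (s * p)
          × HasCount (λ t → f t ≟ k) p
          × Σ ℕ (λ c → HasCount (λ t → f t ≤? k) c × 2 * c + σ ≡ 2 * ((s + 1) * p) + ((n ∸ 1) * p + 1))
          × Σ ℕ (λ S → HasSum (λ t → f t ≟ k) S × 2 * S + p * σ ≡ p * ((2 * s + n) * p))
          × (indicatorSeries (λ t → f t ≟ k) ⊛ psProd (map oneMinusXPow (aList d))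
               ≈ₚ (xPow (s * p) ⊛ psPow (oneMinusXPow p) n))
          × (indicatorSeries (λ t → f t ≥? k) ⊛ psProd (map oneMinusXPow (aList d))
               ≈ₚ (xPow (s * p) ⊛ psPow (oneMinusXPow p) (n ∸ 1))))
proposition1p16 (suc (suc m)) _ d d>0 d! =
  f-values , λ s → max-f≡height s , max-f≤height s , min-f≡height s , min-f≥height s
                 , count-f≡height s , count-f≤height s , sum-f≡height s , series-f≡height s , series-f≥height s
  where open LevelSets m d d>0 d!
proposition1p16 1 (s≤s ()) _ _ _
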